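{- Let $q$ be an odd prime power and let $\chi$ denote the quadratic character of $\mathbb{F}_q$. Let $E$ be a nonsingular elliptic curve over $\mathbb{F}_q$ defined by $y^2=f(x)=x^3+Ax+B$ with $A,B\in\mathbb{F}_q$, and let $(x_0,0)$ be a point of order $2$ on $E$ (so $x_0\in\mathbb{F}_q$ is a root of $f$). Let $n$ be the number of roots of $f(x)$ in $\mathbb{F}_q$, and when $n=3$ let $x_1,x_2$ denote the two roots of $f$ other than $x_0$. Write $f'(x)=3x^2+A$. Then: If $q\equiv 3\bmod 4$: (1) if $\chi(f'(x_0))=1$, then $E(\mathbb{F}_q)$ contains a point of order $4$; (2) otherwise, $E(\mathbb{F}_q)$ contains a point of order $4$ if and only if $n=3$ and $\chi(f'(x_1))=1$. If $q\equiv 1\bmod 4$: (1) if $n=1$, then $E(\mathbb{F}_q)$ contains a point of order $4$ if and only if $\chi(f'(x_0))=1$; (2) otherwise (i.e. $n=3$), if $\chi(f'(x_0))=1$ then $E(\mathbb{F}_q)$ contains a point of order $4$ if and only if $\chi(x_0-x_1)=1$, and if $\chi(f'(x_0))=-1$ then $E(\mathbb{F}_q)$ contains a point of order $4$ if and only if $\chi(x_1-x_2)=1$.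
   Context: The quadratic character $\chi$ on $\mathbb{F}_q$ is defined by $\chi(a)=1$ if $a$ is a nonzero square in $\mathbb{F}_q$, $\chi(a)=-1$ if $a$ is a non-square, and $\chi(0)=0$. -}

module Defs where

open import Level using (0ℓ)
open import Data.Nat as ℕ using (ℕ; zero; suc)
open import Data.Integer as ℤ using (ℤ)
open import Data.Fin using (Fin)
open import Data.Fin.Properties using (any?)
open import Data.Unit using (⊤)
open import Data.Bool using (Bool; true; false; if_then_else_)
open import Data.List using (List; length; filter; map; allFin)
open import Data.Product using (Σ; ∃; _×_; _,_)
open import Relation.Nullary using (¬_; does)
open import Relation.Binary.PropositionalEquality using (_≡_)
open import Relation.Binary.Definitions using (DecidableEquality)
open import Algebra.Structures using (IsCommutativeRing)
open import Function.Bundles using (_↔_; Inverse)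

-- A finite field: a commutative ring (with propositional equality) in which
-- 0 ≠ 1 and every nonzero element has a multiplicative inverse, with decidable
-- equality and an explicit bijection with Fin card, so card = q = |F|.
record FiniteField : Set₁ where
  infixl 6 _+_ _-_
  infixl 7 _*_
  field
    Carrier  : Set
    _+_ _*_  : Carrier → Carrier → Carrier
    -_       : Carrier → Carrier
    0# 1#    : Carrier
    isCommutativeRing : IsCommutativeRing _≡_ _+_ _*_ -_ 0# 1#
    _⁻¹      : Carrier → Carrier
    inverse  : ∀ x → ¬ x ≡ 0# → x * (x ⁻¹) ≡ 1#
    0≢1      : ¬ 0# ≡ 1#
    _≟_      : DecidableEquality Carrier
    card     : ℕ
    enum     : Carrier ↔ Fin card

  _-_ : Carrier → Carrier → Carrier
  x - y = x + (- y)

  -- x / y  (only meaningful for y ≠ 0)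
  _/_ : Carrier → Carrier → Carrier
  x / y = x * (y ⁻¹)

  ι : ℕ → Carrier
  ι zero    = 0#
  ι (suc n) = 1# + ι n

  elements : List Carrier
  elements = map (Inverse.from enum) (allFin card)

  isSquare? : Carrier → Bool
  isSquare? a = does (any? (λ i → (Inverse.from enum i * Inverse.from enum i) ≟ a))

  χ : Carrier → ℤ
  χ a = if does (a ≟ 0#) then ℤ.0ℤ else (if isSquare? a then ℤ.1ℤ else ℤ.-1ℤ)

module Curve (F : FiniteField) (A B : FiniteField.Carrier F) where
  open FiniteField F

  f : Carrier → Carrier
  f x = x * x * x + A * x + B

  f′ : Carrier → Carrier
  f′ x = ι 3 * (x * x) + A

  Nonsingular : Set
  Nonsingular = ¬ (ι 4 * (A * A * A) + ι 27 * (B * B) ≡ 0#)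

  numRoots : ℕ
  numRoots = length (filter (λ x → f x ≟ 0#) elements)

  -- points of the projective curve: the point at infinity O, or affine (x , y)
  data Point : Set where
    O  : Point
    pt : Carrier → Carrier → Point

  OnCurve : Point → Set
  OnCurve O        = ⊤
  OnCurve (pt x y) = y * y ≡ f x

  -- the chord-and-tangent group law on y^2 = x^3 + A x + B
  _⊕_ : Point → Point → Point
  O ⊕ Q = Q
  P ⊕ O = P
  pt x₁ y₁ ⊕ pt x₂ y₂ =
    if does (x₁ ≟ x₂)
    then (if does ((y₁ + y₂) ≟ 0#) then O
          else third ((ι 3 * (x₁ * x₁) + A) / (ι 2 * y₁)))
    else third ((y₂ - y₁) / (x₂ - x₁))
    where
      third : Carrier → Point
      third λ' = let x₃ = λ' * λ' - x₁ - x₂ in pt x₃ (λ' * (x₁ - x₃) - y₁)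

  [_]_ : ℕ → Point → Point
  [ zero ] P  = O
  [ suc k ] P = P ⊕ ([ k ] P)

  HasPointOfOrder4 : Set
  HasPointOfOrder4 = ∃ λ P → OnCurve P × ([ 4 ] P ≡ O) × ¬ ([ 2 ] P ≡ O)

-- A point P of order 4 has 2 P = (e , 0) for a root e of f. Writing P = (e + s , l s), the doubling
-- formula shows that this happens exactly when s² = f′ e and l² = 3 e + 2 s with l ≠ 0 (a halving of e).
-- If f has three roots e₁, e₂, e₃, then f′ e₁ = u v for u = e₁ - e₂, v = e₁ - e₃, and e₁ has a halving
-- iff u and v are squares. If e is the only root, (3 e + 2 s) (3 e - 2 s) = - 3 e² - 4 A is the
-- discriminant of f / (X - e), a nonsquare, so exactly one sign of s works and e has a halving iff
-- f′ e is a square. Euler's criterion, obtained by pairing x with c / x in the product of all units,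
-- makes χ multiplicative and gives χ (-1) = (-1)^((q - 1) / 2); what remains is a finite case analysis
-- on the characters of x₀ - x₁, x₀ - x₂, x₁ - x₂ and -1.

module Submission where

open import Defs
open import Level using (0ℓ)
open import Algebra.Bundles using (CommutativeRing)
open import Algebra.Structures using (IsCommutativeRing)
open import Algebra.Solver.Ring.AlmostCommutativeRing using (fromCommutativeRing; _-Raw-AlmostCommutative⟶_)
open import Data.Bool using (Bool; true; false; not; _∧_; _∨_; T)
open import Data.Bool.Properties using (T-≡; T-∧; T-∨)
open import Data.Empty using (⊥-elim)
open import Data.Fin using (Fin)
open import Data.Fin.Properties using (any?)
open import Data.Integer as ℤ using (ℤ; -[1+_]; 1ℤ; -1ℤ)
import Data.Integer.Properties as ℤ
open import Data.List using (List; []; _∷_; length; filter; map; allFin)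
open import Data.List.Properties using (length-map; length-tabulate)
open import Data.List.Membership.Propositional using (_∈_)
open import Data.List.Membership.Propositional.Properties using (∈-map⁺; ∈-allFin; ∈-filter⁻; ∈-filter⁺)
open import Data.List.Membership.Propositional.Properties.WithK using (unique∧set⇒bag)
open import Data.List.Relation.Binary.BagAndSetEquality using (∼bag⇒↭)
open import Data.List.Relation.Binary.Permutation.Propositional.Properties using (↭-length)
open import Data.List.Relation.Unary.All using (All; []; _∷_; lookup)
open import Data.List.Relation.Unary.Any using (here; there)
open import Data.List.Relation.Unary.AllPairs using ([]; _∷_)
open import Data.List.Relation.Unary.Unique.Propositional using (Unique)
import Data.List.Relation.Unary.Unique.Propositional.Properties as Unique
open import Data.Maybe using (Maybe; just; nothing)
open import Data.Nat as ℕ using (ℕ; zero; suc; _%_)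
import Data.Nat.Properties as ℕ
open import Data.Nat.DivMod using ([m+kn]%n≡m%n)
open import Data.Product using (∃; ∃-syntax; _×_; _,_; proj₁; proj₂)
open import Data.Product.Function.NonDependent.Propositional using (_×-⇔_)
import Data.Sum
open import Data.Sum using (_⊎_; inj₁; inj₂; [_,_]′)
open import Data.Sum.Function.Propositional using (_⊎-⇔_)
open import Function using (_∘_; id)
open import Function.Bundles using (Inverse; _⇔_; mk⇔; module Equivalence)
open import Function.Properties.Equivalence using () renaming (refl to ⇔-refl; sym to ⇔-sym; trans to ⇔-trans)
open import Function.Related.Propositional using (equivalence; module EquationalReasoning)
open import Relation.Nullary using (¬_; Dec; yes; no; ¬?)
open import Relation.Binary.PropositionalEquality using (_≡_; refl; sym; trans; cong; cong₂; subst; module ≡-Reasoning)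

module IntegerCoefficients {c ℓ} (R : CommutativeRing c ℓ) where

  open import Data.Integer using (+_)
  open CommutativeRing R renaming (refl to ≈-refl; sym to ≈-sym)
  open import Algebra.Properties.Ring ring using (-‿distribˡ-*; -‿+-comm)
  open import Relation.Binary.Reasoning.Setoid setoid

  private
    x≈-y+z : ∀ {x y z} → y + x ≈ z → x ≈ - y + z
    x≈-y+z {x} {y} {z} eq = begin
      x              ≈⟨ +-identityˡ x ⟨
      0# + x         ≈⟨ +-congʳ (-‿inverseˡ y) ⟨
      (- y + y) + x  ≈⟨ +-assoc (- y) y x ⟩
      - y + (y + x)  ≈⟨ +-congˡ eq ⟩
      - y + z        ∎

  -- Same unfolding as FiniteField.ι, so that numerals agree definitionally.
  fromℕ : ℕ → Carrier
  fromℕ zero    = 0#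
  fromℕ (suc n) = 1# + fromℕ n

  fromℤ : ℤ → Carrier
  fromℤ (+ n)    = fromℕ n
  fromℤ -[1+ n ] = - fromℕ (suc n)

  fromℤ-cong : ∀ {i j} → i ≡ j → fromℤ i ≈ fromℤ j
  fromℤ-cong refl = ≈-refl

  fromℤ-suc : ∀ i → fromℤ (ℤ.1ℤ ℤ.+ i) ≈ 1# + fromℤ i
  fromℤ-suc (+ n)        = ≈-refl
  fromℤ-suc -[1+ zero ]  = begin
    0#               ≈⟨ -‿inverseʳ 1# ⟨
    1# + - 1#        ≈⟨ +-congˡ (-‿cong (+-identityʳ 1#)) ⟨
    1# + - (1# + 0#) ∎
  fromℤ-suc -[1+ suc n ] = begin
    - fromℕ (suc n)                ≈⟨ x≈-y+z ≈-refl ⟩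
    - 1# + (1# + - fromℕ (suc n))  ≈⟨ +-congˡ (+-comm 1# _) ⟩
    - 1# + (- fromℕ (suc n) + 1#)  ≈⟨ +-assoc (- 1#) _ 1# ⟨
    (- 1# + - fromℕ (suc n)) + 1#  ≈⟨ +-congʳ (-‿+-comm 1# _) ⟩
    - fromℕ (suc (suc n)) + 1#     ≈⟨ +-comm _ 1# ⟩
    1# + - fromℕ (suc (suc n))     ∎

  fromℤ-pred : ∀ i → fromℤ (ℤ.-1ℤ ℤ.+ i) ≈ - 1# + fromℤ i
  fromℤ-pred i = x≈-y+z (begin
    1# + fromℤ (ℤ.-1ℤ ℤ.+ i)       ≈⟨ fromℤ-suc (ℤ.-1ℤ ℤ.+ i) ⟨
    fromℤ (ℤ.1ℤ ℤ.+ (ℤ.-1ℤ ℤ.+ i)) ≈⟨ fromℤ-cong (ℤ.+-assoc ℤ.1ℤ ℤ.-1ℤ i) ⟨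
    fromℤ (ℤ.0ℤ ℤ.+ i)             ≈⟨ fromℤ-cong (ℤ.+-identityˡ i) ⟩
    fromℤ i                        ∎)

  fromℤ-+ : ∀ i j → fromℤ (i ℤ.+ j) ≈ fromℤ i + fromℤ j
  fromℤ-+ (+ zero) j = begin
    fromℤ (ℤ.0ℤ ℤ.+ j)  ≈⟨ fromℤ-cong (ℤ.+-identityˡ j) ⟩
    fromℤ j             ≈⟨ +-identityˡ _ ⟨
    0# + fromℤ j        ∎
  fromℤ-+ (+ suc n) j = begin
    fromℤ ((ℤ.1ℤ ℤ.+ + n) ℤ.+ j)  ≈⟨ fromℤ-cong (ℤ.+-assoc ℤ.1ℤ (+ n) j) ⟩
    fromℤ (ℤ.1ℤ ℤ.+ (+ n ℤ.+ j))  ≈⟨ fromℤ-suc (+ n ℤ.+ j) ⟩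
    1# + fromℤ (+ n ℤ.+ j)        ≈⟨ +-congˡ (fromℤ-+ (+ n) j) ⟩
    1# + (fromℕ n + fromℤ j)      ≈⟨ +-assoc 1# _ _ ⟨
    (1# + fromℕ n) + fromℤ j      ∎
  fromℤ-+ -[1+ zero ] j = begin
    fromℤ (ℤ.-1ℤ ℤ.+ j)    ≈⟨ fromℤ-pred j ⟩
    - 1# + fromℤ j         ≈⟨ +-congʳ (-‿cong (+-identityʳ 1#)) ⟨
    - (1# + 0#) + fromℤ j  ∎
  fromℤ-+ -[1+ suc n ] j = begin
    fromℤ ((ℤ.-1ℤ ℤ.+ -[1+ n ]) ℤ.+ j)  ≈⟨ fromℤ-cong (ℤ.+-assoc ℤ.-1ℤ -[1+ n ] j) ⟩
    fromℤ (ℤ.-1ℤ ℤ.+ (-[1+ n ] ℤ.+ j))  ≈⟨ fromℤ-pred (-[1+ n ] ℤ.+ j) ⟩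
    - 1# + fromℤ (-[1+ n ] ℤ.+ j)       ≈⟨ +-congˡ (fromℤ-+ -[1+ n ] j) ⟩
    - 1# + (fromℤ -[1+ n ] + fromℤ j)   ≈⟨ +-assoc (- 1#) _ _ ⟨
    (- 1# + fromℤ -[1+ n ]) + fromℤ j   ≈⟨ +-congʳ (fromℤ-pred -[1+ n ]) ⟨
    fromℤ -[1+ suc n ] + fromℤ j        ∎

  fromℤ-neg : ∀ i → fromℤ (ℤ.- i) ≈ - fromℤ i
  fromℤ-neg i = begin
    fromℤ (ℤ.- i)                    ≈⟨ x≈-y+z (≈-sym (fromℤ-+ i (ℤ.- i))) ⟩
    - fromℤ i + fromℤ (i ℤ.+ ℤ.- i)  ≈⟨ +-congˡ (fromℤ-cong (ℤ.+-inverseʳ i)) ⟩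
    - fromℤ i + 0#                   ≈⟨ +-identityʳ _ ⟩
    - fromℤ i                        ∎

  fromℤ-+* : ∀ n j → fromℤ (+ n ℤ.* j) ≈ fromℕ n * fromℤ j
  fromℤ-+* zero    j = ≈-sym (zeroˡ _)
  fromℤ-+* (suc n) j = begin
    fromℤ ((ℤ.1ℤ ℤ.+ + n) ℤ.* j)            ≈⟨ fromℤ-cong (ℤ.*-distribʳ-+ j ℤ.1ℤ (+ n)) ⟩
    fromℤ (ℤ.1ℤ ℤ.* j ℤ.+ + n ℤ.* j)        ≈⟨ fromℤ-+ (ℤ.1ℤ ℤ.* j) (+ n ℤ.* j) ⟩
    fromℤ (ℤ.1ℤ ℤ.* j) + fromℤ (+ n ℤ.* j)  ≈⟨ +-cong (fromℤ-cong (ℤ.*-identityˡ j)) (fromℤ-+* n j) ⟩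
    fromℤ j + fromℕ n * fromℤ j             ≈⟨ +-congʳ (*-identityˡ _) ⟨
    1# * fromℤ j + fromℕ n * fromℤ j        ≈⟨ distribʳ _ _ _ ⟨
    (1# + fromℕ n) * fromℤ j                ∎

  fromℤ-* : ∀ i j → fromℤ (i ℤ.* j) ≈ fromℤ i * fromℤ j
  fromℤ-* (+ n)    j = fromℤ-+* n j
  fromℤ-* -[1+ n ] j = begin
    fromℤ (ℤ.- (+ suc n) ℤ.* j)  ≈⟨ fromℤ-cong (ℤ.neg-distribˡ-* (+ suc n) j) ⟨
    fromℤ (ℤ.- (+ suc n ℤ.* j))  ≈⟨ fromℤ-neg (+ suc n ℤ.* j) ⟩
    - fromℤ (+ suc n ℤ.* j)      ≈⟨ -‿cong (fromℤ-+* (suc n) j) ⟩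
    - (fromℕ (suc n) * fromℤ j)  ≈⟨ -‿distribˡ-* _ _ ⟩
    - fromℕ (suc n) * fromℤ j    ∎

  homomorphism : ℤ.+-*-rawRing -Raw-AlmostCommutative⟶ fromCommutativeRing R
  homomorphism = record
    { ⟦_⟧ = fromℤ ; +-homo = fromℤ-+ ; *-homo = fromℤ-* ; -‿homo = fromℤ-neg
    ; 0-homo = ≈-refl ; 1-homo = +-identityʳ 1# }

  _≟-coefficient_ : ∀ i j → Maybe (fromℤ i ≈ fromℤ j)
  i ≟-coefficient j with i ℤ.≟ j
  ... | yes i≡j = just (fromℤ-cong i≡j)
  ... | no _    = nothing

  open import Algebra.Solver.Ring ℤ.+-*-rawRing (fromCommutativeRing R) homomorphism _≟-coefficient_ public

infix 4 _≡ᵇ_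
_≡ᵇ_ : Bool → Bool → Bool
true  ≡ᵇ b = b
false ≡ᵇ b = not b

module FieldFacts (F : FiniteField) where

  open FiniteField F public
  open IsCommutativeRing isCommutativeRing public
    using ( +-comm; *-assoc; *-comm; +-identityˡ; +-identityʳ
          ; *-identityˡ; *-identityʳ; zeroˡ; zeroʳ; -‿inverseʳ )

  commutativeRing : CommutativeRing 0ℓ 0ℓ
  commutativeRing = record { isCommutativeRing = isCommutativeRing }

  open IntegerCoefficients commutativeRing public using (solve; _:=_; _:+_; _:*_; _:-_; :-_; con)
  open import Algebra.Properties.Ring (CommutativeRing.ring commutativeRing) public
    using (x∙y⁻¹≈ε⇒x≈y; x≈y⇒x∙y⁻¹≈ε; +-inverseʳ-unique; -‿involutive; -0#≈0#; -1*x≈-x)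

  1≢0 : ¬ 1# ≡ 0#
  1≢0 = 0≢1 ∘ sym

  -‿≢0 : ∀ {x} → ¬ x ≡ 0# → ¬ - x ≡ 0#
  -‿≢0 {x} x≢0 -x≡0 = x≢0 (trans (sym (-‿involutive x)) (trans (cong -_ -x≡0) -0#≈0#))

  x+y≡z⇒y≡-x+z : ∀ {x y z} → x + y ≡ z → y ≡ - x + z
  x+y≡z⇒y≡-x+z {x} {y} {z} x+y≡z =
    trans (solve 2 (λ x y → y := :- x :+ (x :+ y)) refl x y) (cong (- x +_) x+y≡z)

  -1*-1≡1 : - 1# * - 1# ≡ 1#
  -1*-1≡1 = trans (-1*x≈-x (- 1#)) (-‿involutive 1#)

  x*y≡0⇒x≡0⊎y≡0 : ∀ x y → x * y ≡ 0# → x ≡ 0# ⊎ y ≡ 0#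
  x*y≡0⇒x≡0⊎y≡0 x y xy≡0 with x ≟ 0#
  ... | yes x≡0 = inj₁ x≡0
  ... | no x≢0  = inj₂ (begin
    y                ≡⟨ *-identityˡ y ⟨
    1# * y           ≡⟨ cong (_* y) (trans (*-comm (x ⁻¹) x) (inverse x x≢0)) ⟨
    (x ⁻¹ * x) * y   ≡⟨ *-assoc _ _ _ ⟩
    x ⁻¹ * (x * y)   ≡⟨ cong (x ⁻¹ *_) xy≡0 ⟩
    x ⁻¹ * 0#        ≡⟨ zeroʳ _ ⟩
    0#               ∎)
    where open ≡-Reasoning

  *-≢0 : ∀ {x y} → ¬ x ≡ 0# → ¬ y ≡ 0# → ¬ x * y ≡ 0#
  *-≢0 {x} {y} x≢0 y≢0 xy≡0 = [ x≢0 , y≢0 ]′ (x*y≡0⇒x≡0⊎y≡0 x y xy≡0)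

  *-cancelˡ : ∀ {x y z} → ¬ x ≡ 0# → x * y ≡ x * z → y ≡ z
  *-cancelˡ {x} {y} {z} x≢0 xy≡xz =
    [ ⊥-elim ∘ x≢0 , x∙y⁻¹≈ε⇒x≈y y z ]′ (x*y≡0⇒x≡0⊎y≡0 x (y - z) (trans
      (solve 3 (λ x y z → x :* (y :- z) := x :* y :- x :* z) refl x y z) (x≈y⇒x∙y⁻¹≈ε xy≡xz)))

  x-y≢0 : ∀ {x y} → ¬ x ≡ y → ¬ x - y ≡ 0#
  x-y≢0 {x} {y} x≢y = x≢y ∘ x∙y⁻¹≈ε⇒x≈y x y

  x/y*y≡x : ∀ x {y} → ¬ y ≡ 0# → x / y * y ≡ x
  x/y*y≡x x {y} y≢0 = begin
    x * y ⁻¹ * y    ≡⟨ *-assoc x _ y ⟩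
    x * (y ⁻¹ * y)  ≡⟨ cong (x *_) (trans (*-comm _ y) (inverse y y≢0)) ⟩
    x * 1#          ≡⟨ *-identityʳ x ⟩
    x               ∎
    where open ≡-Reasoning

  x≡z*y⇒x/y≡z : ∀ {x y z} → ¬ y ≡ 0# → x ≡ z * y → x / y ≡ z
  x≡z*y⇒x/y≡z {x} {y} {z} y≢0 x≡zy = *-cancelˡ y≢0 (begin
    y * (x / y)  ≡⟨ *-comm y _ ⟩
    x / y * y    ≡⟨ x/y*y≡x x y≢0 ⟩
    x            ≡⟨ x≡zy ⟩
    z * y        ≡⟨ *-comm z y ⟩
    y * z        ∎)
    where open ≡-Reasoning

  x*x≡y*y⇒x≡±y : ∀ x y → x * x ≡ y * y → x ≡ y ⊎ x ≡ - y
  x*x≡y*y⇒x≡±y x y xx≡yy =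
    Data.Sum.map (x∙y⁻¹≈ε⇒x≈y x y) (x∙y⁻¹≈ε⇒x≈y x (- y) ∘ trans (solve 2 (λ x y → x :- :- y := x :+ y) refl x y))
      (x*y≡0⇒x≡0⊎y≡0 (x - y) (x + y) (trans
        (solve 2 (λ x y → (x :- y) :* (x :+ y) := x :* x :- y :* y) refl x y) (x≈y⇒x∙y⁻¹≈ε xx≡yy)))

  IsSquare : Carrier → Set
  IsSquare a = ∃[ t ] t * t ≡ a

  square-root-≢0 : ∀ {a t} → ¬ a ≡ 0# → t * t ≡ a → ¬ t ≡ 0#
  square-root-≢0 {a} {t} a≢0 tt≡a t≡0 = a≢0 (trans (sym tt≡a) (trans (cong (_* t) t≡0) (zeroˡ t)))

  IsSquare-* : ∀ {a b} → IsSquare a → IsSquare b → IsSquare (a * b)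
  IsSquare-* {a} {b} (s , ss≡a) (t , tt≡b) = s * t , (begin
    (s * t) * (s * t)  ≡⟨ solve 2 (λ s t → (s :* t) :* (s :* t) := (s :* s) :* (t :* t)) refl s t ⟩
    (s * s) * (t * t)  ≡⟨ cong₂ _*_ ss≡a tt≡b ⟩
    a * b              ∎)
    where open ≡-Reasoning

  IsSquare-cancelˡ : ∀ {l u w} → ¬ l ≡ 0# → l * l * u ≡ w * w → IsSquare u
  IsSquare-cancelˡ {l} {u} {w} l≢0 llu≡ww = w / l , *-cancelˡ (*-≢0 l≢0 l≢0) (begin
    (l * l) * ((w / l) * (w / l))  ≡⟨ solve 3 (λ l w m → (l :* l) :* ((w :* m) :* (w :* m)) := (w :* w) :* ((l :* m) :* (l :* m))) refl l w (l ⁻¹) ⟩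
    (w * w) * ((l / l) * (l / l))  ≡⟨ cong (λ z → (w * w) * (z * z)) (inverse l l≢0) ⟩
    (w * w) * (1# * 1#)            ≡⟨ cong ((w * w) *_) (*-identityˡ 1#) ⟩
    (w * w) * 1#                   ≡⟨ *-identityʳ _ ⟩
    w * w                          ≡⟨ llu≡ww ⟨
    l * l * u                      ∎)
    where open ≡-Reasoning

  private
    from : Fin card → Carrier
    from = Inverse.from enum

    to : Carrier → Fin card
    to = Inverse.to enum

    from∘to : ∀ x → from (to x) ≡ x
    from∘to = Inverse.strictlyInverseʳ enum

  ∃? : (P : Carrier → Set) → (∀ x → Dec (P x)) → Dec (∃ P)
  ∃? P P? with any? (P? ∘ from)
  ... | yes (i , Pi) = yes (from i , Pi)
  ... | no ¬∃i       = no λ (x , Px) → ¬∃i (to x , subst P (sym (from∘to x)) Px)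

  isSquare?-sound : ∀ a → isSquare? a ≡ true → IsSquare a
  isSquare?-sound a _ with any? (λ i → (from i * from i) ≟ a)
  ... | yes (i , ii≡a) = from i , ii≡a

  isSquare?-complete : ∀ a → IsSquare a → isSquare? a ≡ true
  isSquare?-complete a (t , tt≡a) with any? (λ i → (from i * from i) ≟ a)
  ... | yes _   = refl
  ... | no ¬∃i  = ⊥-elim (¬∃i (to t , subst (λ x → x * x ≡ a) (sym (from∘to t)) tt≡a))

  isSquare?≡false⇒¬IsSquare : ∀ a → isSquare? a ≡ false → ¬ IsSquare a
  isSquare?≡false⇒¬IsSquare a sq≡false s with () ← trans (sym sq≡false) (isSquare?-complete a s)

  ¬IsSquare⇒isSquare?≡false : ∀ a → ¬ IsSquare a → isSquare? a ≡ false
  ¬IsSquare⇒isSquare?≡false a ¬s with isSquare? a in eq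
  ... | true  = ⊥-elim (¬s (isSquare?-sound a eq))
  ... | false = refl

  χ≡1⇔isSquare? : ∀ {a} → ¬ a ≡ 0# → (χ a ≡ 1ℤ) ⇔ (isSquare? a ≡ true)
  χ≡1⇔isSquare? {a} a≢0 with a ≟ 0#
  ... | yes a≡0 = ⊥-elim (a≢0 a≡0)
  ... | no _ with isSquare? a
  ...   | true  = mk⇔ (λ _ → refl) (λ _ → refl)
  ...   | false = mk⇔ (λ ()) (λ ())

  χ≡-1⇒isSquare?≡false : ∀ {a} → ¬ a ≡ 0# → χ a ≡ -1ℤ → isSquare? a ≡ false
  χ≡-1⇒isSquare?≡false {a} a≢0 with a ≟ 0#
  ... | yes a≡0 = ⊥-elim (a≢0 a≡0)
  ... | no _ with isSquare? a
  ...   | true  = λ ()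
  ...   | false = λ _ → refl

  elements-unique : Unique elements
  elements-unique = Unique.map⁺ from-injective (Unique.allFin⁺ card)
    where
      from-injective : ∀ {i j} → from i ≡ from j → i ≡ j
      from-injective {i} {j} eq = begin
        i            ≡⟨ Inverse.strictlyInverseˡ enum i ⟨
        to (from i)  ≡⟨ cong to eq ⟩
        to (from j)  ≡⟨ Inverse.strictlyInverseˡ enum j ⟩
        j            ∎
        where open ≡-Reasoning

  ∈-elements : ∀ x → x ∈ elements
  ∈-elements x = subst (_∈ elements) (from∘to x) (∈-map⁺ from (∈-allFin (to x)))

  length-elements : length elements ≡ card
  length-elements = trans (length-map from (allFin card)) (length-tabulate (λ i → i))

OddCharacteristic : FiniteField → Set
OddCharacteristic F = ¬ 1# + 1# ≡ 0#
  where open FiniteField F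

module QuadraticCharacter (F : FiniteField) (1+1≢0 : OddCharacteristic F) where

  open FieldFacts F

  product : List Carrier → Carrier
  product []       = 1#
  product (x ∷ xs) = x * product xs

  infixr 8 _^_
  _^_ : Carrier → ℕ → Carrier
  a ^ zero  = 1#
  a ^ suc k = a * a ^ k

  ^-+ : ∀ a m n → a ^ (m ℕ.+ n) ≡ a ^ m * a ^ n
  ^-+ a zero    n = sym (*-identityˡ _)
  ^-+ a (suc m) n = trans (cong (a *_) (^-+ a m n)) (sym (*-assoc _ _ _))

  *-^ : ∀ a b k → (a * b) ^ k ≡ a ^ k * b ^ k
  *-^ a b zero    = sym (*-identityˡ 1#)
  *-^ a b (suc k) = trans (cong ((a * b) *_) (*-^ a b k))
    (solve 4 (λ a b x y → (a :* b) :* (x :* y) := (a :* x) :* (b :* y)) refl a b (a ^ k) (b ^ k))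

  1^ : ∀ k → 1# ^ k ≡ 1#
  1^ zero    = refl
  1^ (suc k) = trans (*-identityˡ _) (1^ k)

  remove : Carrier → List Carrier → List Carrier
  remove y = filter (λ z → ¬? (z ≟ y))

  ∈-remove⁻ : ∀ {y z} xs → z ∈ remove y xs → z ∈ xs × ¬ z ≡ y
  ∈-remove⁻ xs = ∈-filter⁻ (λ z → ¬? (z ≟ _))

  ∈-remove⁺ : ∀ {y z} xs → z ∈ xs → ¬ z ≡ y → z ∈ remove y xs
  ∈-remove⁺ xs = ∈-filter⁺ (λ z → ¬? (z ≟ _))

  remove-unique : ∀ {y xs} → Unique xs → Unique (remove y xs)
  remove-unique = Unique.filter⁺ (λ z → ¬? (z ≟ _))

  remove-∉ : ∀ {y} ws → All (λ w → ¬ y ≡ w) ws → remove y ws ≡ ws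
  remove-∉     []       []         = refl
  remove-∉ {y} (w ∷ ws) (y≢w ∷ ps) with w ≟ y
  ... | yes w≡y = ⊥-elim (y≢w (sym w≡y))
  ... | no _    = cong (w ∷_) (remove-∉ ws ps)

  remove-∈ : ∀ {y} xs → y ∈ xs → Unique xs →
    product xs ≡ y * product (remove y xs) × length xs ≡ suc (length (remove y xs))
  remove-∈ {y} (w ∷ ws) y∈ (w∉ws ∷ ws-unique) with w ≟ y
  ... | yes refl rewrite remove-∉ ws w∉ws = refl , refl
  remove-∈ {y} (w ∷ ws) (here y≡w)  _                  | no w≢y = ⊥-elim (w≢y (sym y≡w))
  remove-∈ {y} (w ∷ ws) (there y∈ws) (_ ∷ ws-unique) | no _ =
    let product≡ , length≡ = remove-∈ ws y∈ws ws-unique in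
    trans (cong (w *_) product≡) (solve 3 (λ w y p → w :* (y :* p) := y :* (w :* p)) refl w y _) ,
    cong suc length≡

  record Pairing (c : Carrier) (xs : List Carrier) : Set where
    field
      partner             : Carrier → Carrier
      partner-∈           : ∀ {x} → x ∈ xs → partner x ∈ xs
      partner-≢           : ∀ {x} → x ∈ xs → ¬ partner x ≡ x
      partner-involutive  : ∀ {x} → x ∈ xs → partner (partner x) ≡ x
      *-partner           : ∀ {x} → x ∈ xs → x * partner x ≡ c

  product-paired : ∀ {c} n xs → length xs ≡ n → Unique xs → Pairing c xs →
    ∃[ k ] length xs ≡ k ℕ.+ k × product xs ≡ c ^ k
  product-paired zero []  _ _ _ = zero , refl , refl
  product-paired (suc zero) (x ∷ []) _ _ p with Pairing.partner-∈ p (here refl)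
  ... | here x′≡x = ⊥-elim (Pairing.partner-≢ p (here refl) x′≡x)
  product-paired {c} (suc (suc n)) (x ∷ ys) length≡ (x∉ys ∷ ys-unique) p =
    suc k , length-x∷ys , product-x∷ys
    where
      open Pairing p
      x′ = partner x
      zs = remove x′ ys

      x′∈ys : x′ ∈ ys
      x′∈ys with partner-∈ (here refl)
      ... | here x′≡x  = ⊥-elim (partner-≢ (here refl) x′≡x)
      ... | there x′∈  = x′∈

      split = remove-∈ ys x′∈ys ys-unique

      zs⊆ys : ∀ {z} → z ∈ zs → z ∈ ys
      zs⊆ys = proj₁ ∘ ∈-remove⁻ ys

      -- partner z = x would give z = x′, and partner z = x′ would give z = x ∉ ys.
      zs-closed : ∀ {z} → z ∈ zs → partner z ∈ zs
      zs-closed {z} z∈zs with partner-∈ (there (zs⊆ys z∈zs))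
      ... | here z′≡x  = ⊥-elim (proj₂ (∈-remove⁻ ys z∈zs)
                           (trans (sym (partner-involutive (there (zs⊆ys z∈zs)))) (cong partner z′≡x)))
      ... | there z′∈ys = ∈-remove⁺ ys z′∈ys λ z′≡x′ → lookup x∉ys (zs⊆ys z∈zs) (sym (begin
                            z                      ≡⟨ partner-involutive (there (zs⊆ys z∈zs)) ⟨
                            partner (partner z)    ≡⟨ cong partner z′≡x′ ⟩
                            partner x′             ≡⟨ partner-involutive (here refl) ⟩
                            x                      ∎))
        where open ≡-Reasoning

      zs-pairing : Pairing c zs
      zs-pairing = record
        { partner            = partner
        ; partner-∈          = zs-closed
        ; partner-≢          = partner-≢ ∘ there ∘ zs⊆ys
        ; partner-involutive = partner-involutive ∘ there ∘ zs⊆ys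
        ; *-partner          = *-partner ∘ there ∘ zs⊆ys
        }

      rec = product-paired n zs
        (ℕ.suc-injective (ℕ.suc-injective (trans (cong suc (sym (proj₂ split))) length≡)))
        (remove-unique ys-unique) zs-pairing
      k = proj₁ rec

      length-x∷ys : suc (length ys) ≡ suc k ℕ.+ suc k
      length-x∷ys = cong suc (trans (proj₂ split) (trans (cong suc (proj₁ (proj₂ rec))) (sym (ℕ.+-suc k k))))

      product-x∷ys : x * product ys ≡ c * c ^ k
      product-x∷ys = begin
        x * product ys           ≡⟨ cong (x *_) (proj₁ split) ⟩
        x * (x′ * product zs)    ≡⟨ *-assoc _ _ _ ⟨
        (x * x′) * product zs    ≡⟨ cong₂ _*_ (*-partner (here refl)) (proj₂ (proj₂ rec)) ⟩
        c * c ^ k                ∎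
        where open ≡-Reasoning

  2≢0 : ¬ ι 2 ≡ 0#
  2≢0 = 1+1≢0 ∘ trans (cong (1# +_) (sym (+-identityʳ 1#)))

  x≢-x : ∀ {x} → ¬ x ≡ 0# → ¬ x ≡ - x
  x≢-x {x} x≢0 x≡-x = [ 2≢0 , x≢0 ]′ (x*y≡0⇒x≡0⊎y≡0 (ι 2) x (begin
    ι 2 * x        ≡⟨ solve 1 (λ x → con (ℤ.+ 2) :* x := x :+ x) refl x ⟩
    x + x          ≡⟨ cong (x +_) x≡-x ⟩
    x - x          ≡⟨ -‿inverseʳ x ⟩
    0#             ∎))
    where open ≡-Reasoning

  units : List Carrier
  units = remove 0# elements

  ∈-units : ∀ {x} → ¬ x ≡ 0# → x ∈ units
  ∈-units {x} = ∈-remove⁺ elements (∈-elements x)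

  units-≢0 : ∀ {x} → x ∈ units → ¬ x ≡ 0#
  units-≢0 = proj₂ ∘ ∈-remove⁻ elements

  units-unique : Unique units
  units-unique = remove-unique elements-unique

  card≡1+length-units : card ≡ suc (length units)
  card≡1+length-units = trans (sym length-elements)
    (proj₂ (remove-∈ elements (∈-elements 0#) elements-unique))

  x*[c/x]≡c : ∀ c {x} → ¬ x ≡ 0# → x * (c / x) ≡ c
  x*[c/x]≡c c {x} x≢0 = trans (*-comm x _) (x/y*y≡x c x≢0)

  c/x≢0 : ∀ {c x} → ¬ c ≡ 0# → ¬ x ≡ 0# → ¬ c / x ≡ 0#
  c/x≢0 {c} {x} c≢0 x≢0 c/x≡0 = c≢0 (begin
    c            ≡⟨ x*[c/x]≡c c x≢0 ⟨
    x * (c / x)  ≡⟨ cong (x *_) c/x≡0 ⟩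
    x * 0#       ≡⟨ zeroʳ x ⟩
    0#           ∎)
    where open ≡-Reasoning

  division-pairing : ∀ {c} xs → ¬ c ≡ 0# → (∀ {x} → x ∈ xs → ¬ x ≡ 0#) →
    (∀ {x} → x ∈ xs → c / x ∈ xs) → (∀ {x} → x ∈ xs → ¬ x * x ≡ c) → Pairing c xs
  division-pairing {c} xs c≢0 xs-≢0 closed no-root = record
    { partner            = c /_
    ; partner-∈          = closed
    ; partner-≢          = λ x∈ c/x≡x → no-root x∈ (trans (cong (_ *_) (sym c/x≡x)) (x*[c/x]≡c c (xs-≢0 x∈)))
    ; partner-involutive = λ x∈ → *-cancelˡ (c/x≢0 c≢0 (xs-≢0 x∈))
        (trans (x*[c/x]≡c c (c/x≢0 c≢0 (xs-≢0 x∈))) (sym (trans (*-comm _ _) (x*[c/x]≡c c (xs-≢0 x∈)))))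
    ; *-partner          = x*[c/x]≡c c ∘ xs-≢0
    }

  product-units-nonsquare : ∀ {c} → ¬ c ≡ 0# → ¬ IsSquare c →
    ∃[ k ] length units ≡ k ℕ.+ k × product units ≡ c ^ k
  product-units-nonsquare {c} c≢0 ¬□c = product-paired _ units refl units-unique
    (division-pairing units c≢0 units-≢0 (∈-units ∘ c/x≢0 c≢0 ∘ units-≢0) (λ {x} _ xx≡c → ¬□c (x , xx≡c)))

  -- The two square roots ±t of t * t are removed first; the rest pairs up under x ↦ t * t / x.
  product-units-square : ∀ {t} → ¬ t ≡ 0# →
    ∃[ k ] length units ≡ k ℕ.+ k × product units ≡ - ((t * t) ^ k)
  product-units-square {t} t≢0 = suc k , length≡ , product≡
    where
      c = t * t
      c≢0 = *-≢0 t≢0 t≢0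
      units∖-t = remove (- t) units
      ws = remove t units∖-t

      split-t = remove-∈ units (∈-units (-‿≢0 t≢0)) units-unique
      split+t = remove-∈ units∖-t (∈-remove⁺ units (∈-units t≢0) (x≢-x t≢0)) (remove-unique units-unique)

      ws⊆units : ∀ {x} → x ∈ ws → x ∈ units
      ws⊆units = proj₁ ∘ ∈-remove⁻ units ∘ proj₁ ∘ ∈-remove⁻ units∖-t

      ws-≢t : ∀ {x} → x ∈ ws → ¬ x ≡ t
      ws-≢t = proj₂ ∘ ∈-remove⁻ units∖-t

      ws-≢-t : ∀ {x} → x ∈ ws → ¬ x ≡ - t
      ws-≢-t = proj₂ ∘ ∈-remove⁻ units ∘ proj₁ ∘ ∈-remove⁻ units∖-t

      ws-no-root : ∀ {x} → x ∈ ws → ¬ x * x ≡ c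
      ws-no-root x∈ xx≡tt = [ ws-≢t x∈ , ws-≢-t x∈ ]′ (x*x≡y*y⇒x≡±y _ t xx≡tt)

      c/x≡root⇒x≡root : ∀ {x s} → x ∈ ws → s * s ≡ c → c / x ≡ s → x ≡ s
      c/x≡root⇒x≡root {x} {s} x∈ ss≡c c/x≡s = *-cancelˡ (square-root-≢0 c≢0 ss≡c) (begin
        s * x        ≡⟨ *-comm s x ⟩
        x * s        ≡⟨ cong (x *_) c/x≡s ⟨
        x * (c / x)  ≡⟨ x*[c/x]≡c c (units-≢0 (ws⊆units x∈)) ⟩
        c            ≡⟨ ss≡c ⟨
        s * s        ∎)
        where open ≡-Reasoning

      ws-closed : ∀ {x} → x ∈ ws → c / x ∈ ws
      ws-closed x∈ =
        ∈-remove⁺ units∖-t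
          (∈-remove⁺ units (∈-units (c/x≢0 c≢0 (units-≢0 (ws⊆units x∈))))
            (ws-≢-t x∈ ∘ c/x≡root⇒x≡root x∈ (solve 1 (λ t → (:- t) :* (:- t) := t :* t) refl t)))
          (ws-≢t x∈ ∘ c/x≡root⇒x≡root x∈ refl)

      rec = product-paired _ ws refl (remove-unique (remove-unique units-unique))
        (division-pairing ws c≢0 (units-≢0 ∘ ws⊆units) ws-closed ws-no-root)
      k = proj₁ rec

      length≡ : length units ≡ suc k ℕ.+ suc k
      length≡ = trans (proj₂ split-t) (cong suc (trans (proj₂ split+t)
        (trans (cong suc (proj₁ (proj₂ rec))) (sym (ℕ.+-suc k k)))))

      product≡ : product units ≡ - (c * c ^ k)
      product≡ = begin
        product units                    ≡⟨ proj₁ split-t ⟩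
        - t * product units∖-t           ≡⟨ cong (- t *_) (proj₁ split+t) ⟩
        - t * (t * product ws)           ≡⟨ cong (λ p → - t * (t * p)) (proj₂ (proj₂ rec)) ⟩
        - t * (t * c ^ k)                ≡⟨ solve 2 (λ t p → (:- t) :* (t :* p) := :- ((t :* t) :* p)) refl t (c ^ k) ⟩
        - (c * c ^ k)                    ∎
        where open ≡-Reasoning

  k+k≡j+j⇒k≡j : ∀ {k j} → k ℕ.+ k ≡ j ℕ.+ j → k ≡ j
  k+k≡j+j⇒k≡j {k} {j} eq = ℕ.*-cancelˡ-≡ k j 2 (begin
    k ℕ.+ (k ℕ.+ 0)  ≡⟨ cong (k ℕ.+_) (ℕ.+-identityʳ k) ⟩
    k ℕ.+ k          ≡⟨ eq ⟩
    j ℕ.+ j          ≡⟨ cong (j ℕ.+_) (ℕ.+-identityʳ j) ⟨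
    j ℕ.+ (j ℕ.+ 0)  ∎)
    where open ≡-Reasoning

  -- K = (q - 1) / 2. Opaque: unfolding it would normalise the whole pairing argument.
  opaque
    K : ℕ
    K = proj₁ (product-units-square 1≢0)

    length-units≡K+K : length units ≡ K ℕ.+ K
    length-units≡K+K = proj₁ (proj₂ (product-units-square 1≢0))

    product-units≡-1^K : product units ≡ - ((1# * 1#) ^ K)
    product-units≡-1^K = proj₂ (proj₂ (product-units-square 1≢0))

  card≡1+K+K : card ≡ suc (K ℕ.+ K)
  card≡1+K+K = trans card≡1+length-units (cong suc length-units≡K+K)

  wilson : product units ≡ - 1#
  wilson = trans product-units≡-1^K (cong -_ (trans (cong (_^ K) (*-identityˡ 1#)) (1^ K)))

  exponent≡K : ∀ {k} → length units ≡ k ℕ.+ k → k ≡ K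
  exponent≡K length≡ = k+k≡j+j⇒k≡j (trans (sym length≡) length-units≡K+K)

  euler-square : ∀ {t} → ¬ t ≡ 0# → (t * t) ^ K ≡ 1#
  euler-square {t} t≢0 = from-product (product-units-square t≢0)
    where
      from-product : ∃[ k ] length units ≡ k ℕ.+ k × product units ≡ - ((t * t) ^ k) → (t * t) ^ K ≡ 1#
      from-product (k , length≡ , product≡) = subst (λ j → (t * t) ^ j ≡ 1#) (exponent≡K {k} length≡)
        (trans (sym (-‿involutive _)) (trans (cong -_ (trans (sym product≡) wilson)) (-‿involutive 1#)))

  euler-nonsquare : ∀ {c} → ¬ c ≡ 0# → ¬ IsSquare c → c ^ K ≡ - 1#
  euler-nonsquare {c} c≢0 ¬□c = from-product (product-units-nonsquare c≢0 ¬□c)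
    where
      from-product : ∃[ k ] length units ≡ k ℕ.+ k × product units ≡ c ^ k → c ^ K ≡ - 1#
      from-product (k , length≡ , product≡) =
        subst (λ j → c ^ j ≡ - 1#) (exponent≡K {k} length≡) (trans (sym product≡) wilson)

  nonsquare*nonsquare : ∀ {a b} → ¬ a ≡ 0# → ¬ b ≡ 0# → ¬ IsSquare a → ¬ IsSquare b → IsSquare (a * b)
  nonsquare*nonsquare {a} {b} a≢0 b≢0 ¬□a ¬□b with isSquare? (a * b) in eq
  ... | true  = isSquare?-sound (a * b) eq
  ... | false = ⊥-elim (x≢-x 1≢0 (begin
    1#                   ≡⟨ -1*-1≡1 ⟨
    (- 1#) * (- 1#)      ≡⟨ cong₂ _*_ (euler-nonsquare a≢0 ¬□a) (euler-nonsquare b≢0 ¬□b) ⟨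
    a ^ K * b ^ K        ≡⟨ *-^ a b K ⟨
    (a * b) ^ K          ≡⟨ euler-nonsquare (*-≢0 a≢0 b≢0) (isSquare?≡false⇒¬IsSquare (a * b) eq) ⟩
    - 1#                 ∎))
    where open ≡-Reasoning

  isSquare?-* : ∀ {a b} → ¬ a ≡ 0# → ¬ b ≡ 0# → isSquare? (a * b) ≡ (isSquare? a ≡ᵇ isSquare? b)
  isSquare?-* {a} {b} a≢0 b≢0 with isSquare? a in eqa | isSquare? b in eqb
  ... | true | true = isSquare?-complete (a * b) (IsSquare-* (isSquare?-sound a eqa) (isSquare?-sound b eqb))
  ... | true | false = ¬IsSquare⇒isSquare?≡false (a * b) λ (w , ww≡ab) →
    let s , ss≡a = isSquare?-sound a eqa in
    isSquare?≡false⇒¬IsSquare b eqb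
      (IsSquare-cancelˡ (square-root-≢0 a≢0 ss≡a) (trans (cong (_* b) ss≡a) (sym ww≡ab)))
  ... | false | true = ¬IsSquare⇒isSquare?≡false (a * b) λ (w , ww≡ab) →
    let t , tt≡b = isSquare?-sound b eqb in
    isSquare?≡false⇒¬IsSquare a eqa
      (IsSquare-cancelˡ (square-root-≢0 b≢0 tt≡b) (trans (cong (_* a) tt≡b) (trans (*-comm b a) (sym ww≡ab))))
  ... | false | false = isSquare?-complete (a * b)
    (nonsquare*nonsquare a≢0 b≢0 (isSquare?≡false⇒¬IsSquare a eqa) (isSquare?≡false⇒¬IsSquare b eqb))

  isSquare?-neg : ∀ {a} → ¬ a ≡ 0# → isSquare? (- a) ≡ (isSquare? (- 1#) ≡ᵇ isSquare? a)
  isSquare?-neg {a} a≢0 = trans (cong isSquare? (sym (-1*x≈-x a))) (isSquare?-* (-‿≢0 1≢0) a≢0)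

  parity : ∀ n → ∃[ j ] (n ≡ j ℕ.+ j ⊎ n ≡ suc (j ℕ.+ j))
  parity zero    = zero , inj₁ refl
  parity (suc n) with parity n
  ... | j , inj₁ n≡j+j = j , inj₂ (cong suc n≡j+j)
  ... | j , inj₂ n≡1+j+j = suc j , inj₁ (trans (cong suc n≡1+j+j) (sym (cong suc (ℕ.+-suc j j))))

  -1^[j+j]≡1 : ∀ j → (- 1#) ^ (j ℕ.+ j) ≡ 1#
  -1^[j+j]≡1 j = begin
    (- 1#) ^ (j ℕ.+ j)          ≡⟨ ^-+ (- 1#) j j ⟩
    (- 1#) ^ j * (- 1#) ^ j     ≡⟨ *-^ (- 1#) (- 1#) j ⟨
    (- 1# * - 1#) ^ j           ≡⟨ cong (_^ j) -1*-1≡1 ⟩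
    1# ^ j                      ≡⟨ 1^ j ⟩
    1#                          ∎
    where open ≡-Reasoning

  j+j+[j+j]≡j*4 : ∀ j → (j ℕ.+ j) ℕ.+ (j ℕ.+ j) ≡ j ℕ.* 4
  j+j+[j+j]≡j*4 j = trans (ℕ.+-assoc j j (j ℕ.+ j))
    (trans (cong (λ z → j ℕ.+ (j ℕ.+ (j ℕ.+ z))) (sym (ℕ.+-identityʳ j))) (ℕ.*-comm 4 j))

  K-even⇒card%4≡1 : ∀ {j} → K ≡ j ℕ.+ j → card % 4 ≡ 1
  K-even⇒card%4≡1 {j} K≡j+j = begin
    card % 4                               ≡⟨ cong (_% 4) card≡1+K+K ⟩
    suc (K ℕ.+ K) % 4                      ≡⟨ cong (λ k → suc (k ℕ.+ k) % 4) K≡j+j ⟩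
    suc ((j ℕ.+ j) ℕ.+ (j ℕ.+ j)) % 4      ≡⟨ cong (λ n → suc n % 4) (j+j+[j+j]≡j*4 j) ⟩
    suc (j ℕ.* 4) % 4                      ≡⟨ [m+kn]%n≡m%n 1 j 4 ⟩
    1                                      ∎
    where open ≡-Reasoning

  K-odd⇒card%4≡3 : ∀ {j} → K ≡ suc (j ℕ.+ j) → card % 4 ≡ 3
  K-odd⇒card%4≡3 {j} K≡1+j+j = begin
    card % 4                                     ≡⟨ cong (_% 4) card≡1+K+K ⟩
    suc (K ℕ.+ K) % 4                            ≡⟨ cong (λ k → suc (k ℕ.+ k) % 4) K≡1+j+j ⟩
    suc (suc ((j ℕ.+ j) ℕ.+ suc (j ℕ.+ j))) % 4  ≡⟨ cong (λ n → suc (suc n) % 4) (ℕ.+-suc (j ℕ.+ j) (j ℕ.+ j)) ⟩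
    (3 ℕ.+ ((j ℕ.+ j) ℕ.+ (j ℕ.+ j))) % 4        ≡⟨ cong (λ n → (3 ℕ.+ n) % 4) (j+j+[j+j]≡j*4 j) ⟩
    (3 ℕ.+ j ℕ.* 4) % 4                          ≡⟨ [m+kn]%n≡m%n 3 j 4 ⟩
    3                                            ∎
    where open ≡-Reasoning

  -- (-1)^K is 1 or -1 according to the parity of K, and q = 2 K + 1.
  card%4≡1⇒isSquare?-1 : card % 4 ≡ 1 → isSquare? (- 1#) ≡ true
  card%4≡1⇒isSquare?-1 card%4≡1 with parity K
  ... | j , inj₂ K≡1+j+j = ⊥-elim (1≢3 (trans (sym card%4≡1) (K-odd⇒card%4≡3 {j} K≡1+j+j)))
    where 1≢3 : ¬ 1 ≡ 3
          1≢3 ()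
  ... | j , inj₁ K≡j+j with isSquare? (- 1#) in eq
  ...   | true  = refl
  ...   | false = ⊥-elim (x≢-x 1≢0 (begin
    1#               ≡⟨ -1^[j+j]≡1 j ⟨
    (- 1#) ^ (j ℕ.+ j) ≡⟨ cong ((- 1#) ^_) K≡j+j ⟨
    (- 1#) ^ K       ≡⟨ euler-nonsquare (-‿≢0 1≢0) (isSquare?≡false⇒¬IsSquare (- 1#) eq) ⟩
    - 1#             ∎))
    where open ≡-Reasoning

  card%4≡3⇒¬isSquare?-1 : card % 4 ≡ 3 → isSquare? (- 1#) ≡ false
  card%4≡3⇒¬isSquare?-1 card%4≡3 with parity K
  ... | j , inj₁ K≡j+j = ⊥-elim (3≢1 (trans (sym card%4≡3) (K-even⇒card%4≡1 {j} K≡j+j)))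
    where 3≢1 : ¬ 3 ≡ 1
          3≢1 ()
  ... | j , inj₂ K≡1+j+j with isSquare? (- 1#) in eq
  ...   | false = refl
  ...   | true  = ⊥-elim (x≢-x 1≢0 (begin
    1#                         ≡⟨ euler-square (square-root-≢0 (-‿≢0 1≢0) tt≡-1) ⟨
    (t * t) ^ K                ≡⟨ cong (_^ K) tt≡-1 ⟩
    (- 1#) ^ K                 ≡⟨ cong ((- 1#) ^_) K≡1+j+j ⟩
    - 1# * (- 1#) ^ (j ℕ.+ j)  ≡⟨ cong (- 1# *_) (-1^[j+j]≡1 j) ⟩
    - 1# * 1#                  ≡⟨ *-identityʳ (- 1#) ⟩
    - 1#                       ∎))
    where open ≡-Reasoning
          t = proj₁ (isSquare?-sound (- 1#) eq)
          tt≡-1 = proj₂ (isSquare?-sound (- 1#) eq)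

module CurveFacts (F : FiniteField) (1+1≢0 : OddCharacteristic F) (A B : FiniteField.Carrier F) where

  open FieldFacts F
  open QuadraticCharacter F 1+1≢0
  open Curve F A B

  -- The sum of (x₁ , y₁) and the point of abscissa x₂ on the line of slope m through (x₁ , y₁).
  third : Carrier → Carrier → Carrier → Carrier → Point
  third x₁ y₁ x₂ m = pt (m * m - x₁ - x₂) (m * (x₁ - (m * m - x₁ - x₂)) - y₁)

  pt≢O : ∀ {x y} → ¬ pt x y ≡ O
  pt≢O ()

  ⊕≡O⇒ : ∀ x₁ y₁ x₂ y₂ → pt x₁ y₁ ⊕ pt x₂ y₂ ≡ O → x₁ ≡ x₂ × y₁ + y₂ ≡ 0#
  ⊕≡O⇒ x₁ y₁ x₂ y₂ sum≡O with x₁ ≟ x₂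
  ... | no _ = ⊥-elim (pt≢O sum≡O)
  ... | yes x₁≡x₂ with (y₁ + y₂) ≟ 0#
  ...   | yes y₁+y₂≡0 = x₁≡x₂ , y₁+y₂≡0
  ...   | no _        = ⊥-elim (pt≢O sum≡O)

  ⊕-inverse : ∀ {x₁ y₁ x₂ y₂} → x₁ ≡ x₂ → y₁ + y₂ ≡ 0# → pt x₁ y₁ ⊕ pt x₂ y₂ ≡ O
  ⊕-inverse {x₁} {y₁} {x₂} {y₂} x₁≡x₂ y₁+y₂≡0 with x₁ ≟ x₂
  ... | no x₁≢x₂ = ⊥-elim (x₁≢x₂ x₁≡x₂)
  ... | yes _ with (y₁ + y₂) ≟ 0#
  ...   | yes _        = refl
  ...   | no y₁+y₂≢0   = ⊥-elim (y₁+y₂≢0 y₁+y₂≡0)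

  ⊕-chord : ∀ {x₁ y₁ x₂ y₂} m → ¬ x₁ ≡ x₂ → y₂ - y₁ ≡ m * (x₂ - x₁) →
    pt x₁ y₁ ⊕ pt x₂ y₂ ≡ third x₁ y₁ x₂ m
  ⊕-chord {x₁} {y₁} {x₂} {y₂} m x₁≢x₂ slope with x₁ ≟ x₂
  ... | yes x₁≡x₂ = ⊥-elim (x₁≢x₂ x₁≡x₂)
  ... | no _ = cong (third x₁ y₁ x₂) (x≡z*y⇒x/y≡z (x-y≢0 (x₁≢x₂ ∘ sym)) slope)

  y+y≢0 : ∀ {y} → ¬ y ≡ 0# → ¬ y + y ≡ 0#
  y+y≢0 {y} y≢0 = *-≢0 2≢0 y≢0 ∘ trans (solve 1 (λ y → con (ℤ.+ 2) :* y := y :+ y) refl y)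

  ⊕-double : ∀ {x y} l → ¬ y ≡ 0# → f′ x ≡ l * (ι 2 * y) → pt x y ⊕ pt x y ≡ third x y x l
  ⊕-double {x} {y} l y≢0 tangent with x ≟ x
  ... | no x≢x = ⊥-elim (x≢x refl)
  ... | yes _ with (y + y) ≟ 0#
  ...   | yes y+y≡0 = ⊥-elim (y+y≢0 y≢0 y+y≡0)
  ...   | no _ = cong (third x y x) (x≡z*y⇒x/y≡z (*-≢0 2≢0 y≢0) tangent)

  f≡0∧f′≡0⇒singular : ∀ {e} → f e ≡ 0# → f′ e ≡ 0# → ¬ Nonsingular
  f≡0∧f′≡0⇒singular {e} fe≡0 f′e≡0 nonsingular = nonsingular (begin
    ι 4 * (A * A * A) + ι 27 * (B * B)  ≡⟨ cong₂ (λ a b → ι 4 * (a * a * a) + ι 27 * (b * b)) A≡ B≡ ⟩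
    ι 4 * (a * a * a) + ι 27 * (b * b)  ≡⟨ solve 1 (λ e → let a = :- (con (ℤ.+ 3) :* (e :* e)) ; b = :- (e :* e :* e :+ a :* e) in
                                             con (ℤ.+ 4) :* (a :* a :* a) :+ con (ℤ.+ 27) :* (b :* b) := con (ℤ.+ 0)) refl e ⟩
    0#                                  ∎)
    where
      open ≡-Reasoning
      a = - (ι 3 * (e * e))
      b = - (e * e * e + a * e)
      A≡ : A ≡ a
      A≡ = +-inverseʳ-unique (ι 3 * (e * e)) A f′e≡0
      B≡ : B ≡ b
      B≡ = trans (+-inverseʳ-unique (e * e * e + A * e) B fe≡0) (cong (λ a → - (e * e * e + a * e)) A≡)

  -- For P = (e + s , l * s), the tangent at P has slope l and meets the curve again at (e , 0), so 2 P = (e , 0).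
  record Halving (e : Carrier) : Set where
    field
      s l        : Carrier
      s*s≡f′e    : s * s ≡ f′ e
      l*l≡3e+2s  : l * l ≡ ι 3 * e + ι 2 * s
      l≢0        : ¬ l ≡ 0#

  on-curve-at-halving : ∀ {e s l} → f e ≡ 0# → s * s ≡ f′ e → l * l ≡ ι 3 * e + ι 2 * s →
    (l * s) * (l * s) ≡ f (e + s)
  on-curve-at-halving {e} {s} {l} fe≡0 s*s≡f′e l*l≡3e+2s = sym (begin
    f (e + s)                                 ≡⟨ solve 4 (λ e s A B → (e :+ s) :* (e :+ s) :* (e :+ s) :+ A :* (e :+ s) :+ B
                                                     := (e :* e :* e :+ A :* e :+ B) :+ (con (ℤ.+ 3) :* (e :* e) :+ A) :* s
                                                        :+ s :* s :* (con (ℤ.+ 3) :* e :+ s)) refl e s A B ⟩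
    f e + f′ e * s + s * s * (ι 3 * e + s)    ≡⟨ cong₂ (λ a b → a + b * s + s * s * (ι 3 * e + s)) fe≡0 (sym s*s≡f′e) ⟩
    0# + (s * s) * s + s * s * (ι 3 * e + s)  ≡⟨ solve 2 (λ e s → con (ℤ.+ 0) :+ (s :* s) :* s :+ s :* s :* (con (ℤ.+ 3) :* e :+ s)
                                                     := s :* s :* (con (ℤ.+ 3) :* e :+ con (ℤ.+ 2) :* s)) refl e s ⟩
    s * s * (ι 3 * e + ι 2 * s)               ≡⟨ cong (s * s *_) l*l≡3e+2s ⟨
    s * s * (l * l)                           ≡⟨ solve 2 (λ s l → s :* s :* (l :* l) := (l :* s) :* (l :* s)) refl s l ⟩
    (l * s) * (l * s)                         ∎)
    where open ≡-Reasoning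

  tangent-at-halving : ∀ {e s l} → s * s ≡ f′ e → l * l ≡ ι 3 * e + ι 2 * s → f′ (e + s) ≡ l * (ι 2 * (l * s))
  tangent-at-halving {e} {s} {l} s*s≡f′e l*l≡3e+2s = begin
    f′ (e + s)                              ≡⟨ solve 3 (λ e s A → con (ℤ.+ 3) :* ((e :+ s) :* (e :+ s)) :+ A
                                                   := (con (ℤ.+ 3) :* (e :* e) :+ A) :+ con (ℤ.+ 6) :* e :* s :+ con (ℤ.+ 3) :* (s :* s)) refl e s A ⟩
    f′ e + ι 6 * e * s + ι 3 * (s * s)      ≡⟨ cong (λ a → a + ι 6 * e * s + ι 3 * (s * s)) s*s≡f′e ⟨
    s * s + ι 6 * e * s + ι 3 * (s * s)     ≡⟨ solve 2 (λ e s → s :* s :+ con (ℤ.+ 6) :* e :* s :+ con (ℤ.+ 3) :* (s :* s)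
                                                   := con (ℤ.+ 2) :* s :* (con (ℤ.+ 3) :* e :+ con (ℤ.+ 2) :* s)) refl e s ⟩
    ι 2 * s * (ι 3 * e + ι 2 * s)           ≡⟨ cong (ι 2 * s *_) l*l≡3e+2s ⟨
    ι 2 * s * (l * l)                       ≡⟨ solve 2 (λ s l → con (ℤ.+ 2) :* s :* (l :* l) := l :* (con (ℤ.+ 2) :* (l :* s))) refl s l ⟩
    l * (ι 2 * (l * s))                     ∎
    where open ≡-Reasoning

  halving⇒order4 : Nonsingular → ∀ {e} → f e ≡ 0# → Halving e → HasPointOfOrder4
  halving⇒order4 nonsingular {e} fe≡0 h =
    P , on-curve-at-halving fe≡0 s*s≡f′e l*l≡3e+2s , [4]P≡O , pt≢O ∘ trans (sym [2]P≡e)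
    where
      open Halving h
      open ≡-Reasoning
      x = e + s
      y = l * s
      P = pt x y

      s≢0 : ¬ s ≡ 0#
      s≢0 s≡0 = f≡0∧f′≡0⇒singular fe≡0 (trans (sym s*s≡f′e) (trans (cong (_* s) s≡0) (zeroˡ s))) nonsingular

      [2]P≡e : P ⊕ P ≡ pt e 0#
      [2]P≡e = trans (⊕-double l (*-≢0 l≢0 s≢0) (tangent-at-halving s*s≡f′e l*l≡3e+2s))
        (cong₂ pt x₃≡e (trans (cong (λ z → l * (x - z) - y) x₃≡e)
          (solve 3 (λ e s l → l :* ((e :+ s) :- e) :- l :* s := con (ℤ.+ 0)) refl e s l)))
        where
          x₃≡e : l * l - x - x ≡ e
          x₃≡e = trans (cong (λ z → z - x - x) l*l≡3e+2s)
            (solve 2 (λ e s → con (ℤ.+ 3) :* e :+ con (ℤ.+ 2) :* s :- (e :+ s) :- (e :+ s) := e) refl e s)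

      [3]P≡-P : P ⊕ pt e 0# ≡ pt x (- y)
      [3]P≡-P = trans (⊕-chord l x≢e (solve 3 (λ e s l → con (ℤ.+ 0) :- l :* s := l :* (e :- (e :+ s))) refl e s l))
        (cong₂ pt x₄≡x (trans (cong (λ z → l * (x - z) - y) x₄≡x) (solve 3 (λ x y l → l :* (x :- x) :- y := :- y) refl x y l)))
        where
          x≢e : ¬ x ≡ e
          x≢e x≡e = s≢0 (trans (solve 2 (λ e s → s := (e :+ s) :- e) refl e s) (x≈y⇒x∙y⁻¹≈ε x≡e))
          x₄≡x : l * l - x - e ≡ x
          x₄≡x = trans (cong (λ z → z - x - e) l*l≡3e+2s)
            (solve 2 (λ e s → con (ℤ.+ 3) :* e :+ con (ℤ.+ 2) :* s :- (e :+ s) :- e := e :+ s) refl e s)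

      [4]P≡O : [ 4 ] P ≡ O
      [4]P≡O = begin
        P ⊕ (P ⊕ (P ⊕ P))  ≡⟨ cong (λ Q → P ⊕ (P ⊕ Q)) [2]P≡e ⟩
        P ⊕ (P ⊕ pt e 0#)  ≡⟨ cong (P ⊕_) [3]P≡-P ⟩
        P ⊕ pt x (- y)     ≡⟨ ⊕-inverse refl (-‿inverseʳ y) ⟩
        O                  ∎

  -- The last hypothesis says that the tangent at (x , y) passes through (e , 0).
  tangent-to-root⇒halving : ∀ {x y L} → y * y ≡ f x → ¬ y ≡ 0# → f′ x ≡ L * (ι 2 * y) →
    let e = L * L - x - x in L * (x - e) ≡ y → f e ≡ 0# × Halving e
  tangent-to-root⇒halving {x} {y} {L} on-curve y≢0 tangent Ls≡y = fe≡0 , halving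
    where
      open ≡-Reasoning
      e = L * L - x - x
      s = x - e
      A≡ : A ≡ - (ι 3 * (x * x)) + L * (ι 2 * (L * s))
      A≡ = trans (x+y≡z⇒y≡-x+z tangent) (cong (λ z → - (ι 3 * (x * x)) + L * (ι 2 * z)) (sym Ls≡y))

      fe≡0 : f e ≡ 0#
      fe≡0 = begin
        e * e * e + A * e + B  ≡⟨ cong₂ (λ a b → e * e * e + a * e + b) A≡ B≡ ⟩
        e * e * e + a * e + b  ≡⟨ solve 2 (λ x L → let e = L :* L :- x :- x ; s = x :- e
                                                        ; a = :- (con (ℤ.+ 3) :* (x :* x)) :+ L :* (con (ℤ.+ 2) :* (L :* s)) in
                                           e :* e :* e :+ a :* e :+ (:- (x :* x :* x :+ a :* x) :+ (L :* s) :* (L :* s))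
                                           := con (ℤ.+ 0)) refl x L ⟩
        0#                     ∎
        where
          a = - (ι 3 * (x * x)) + L * (ι 2 * (L * s))
          b = - (x * x * x + a * x) + (L * s) * (L * s)
          B≡ : B ≡ b
          B≡ = trans (x+y≡z⇒y≡-x+z (sym on-curve)) (cong₂ (λ a y → - (x * x * x + a * x) + y * y) A≡ (sym Ls≡y))

      halving : Halving e
      halving = record
        { s = s ; l = L
        ; s*s≡f′e = sym (begin
            ι 3 * (e * e) + A                                         ≡⟨ cong (ι 3 * (e * e) +_) A≡ ⟩
            ι 3 * (e * e) + (- (ι 3 * (x * x)) + L * (ι 2 * (L * s)))  ≡⟨ solve 2 (λ x L → let e = L :* L :- x :- x ; s = x :- e in
                                                                            con (ℤ.+ 3) :* (e :* e) :+ (:- (con (ℤ.+ 3) :* (x :* x)) :+ L :* (con (ℤ.+ 2) :* (L :* s)))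
                                                                            := s :* s) refl x L ⟩
            s * s                                                     ∎)
        ; l*l≡3e+2s = solve 2 (λ x L → let e = L :* L :- x :- x in L :* L := con (ℤ.+ 3) :* e :+ con (ℤ.+ 2) :* (x :- e)) refl x L
        ; l≢0 = λ L≡0 → y≢0 (trans (sym Ls≡y) (trans (cong (_* s) L≡0) (zeroˡ s)))
        }

  -- 4 P = O forces 2 P = (x₃ , y₃) to have y₃ = 0: the chord through P and 2 P must have the tangent's slope ±L.
  [4]P≡O⇒[2]P-on-x-axis : ∀ {x y L} → ¬ y ≡ 0# →
    let x₃ = L * L - x - x in pt x y ⊕ (pt x y ⊕ third x y x L) ≡ O → L * (x - x₃) ≡ y
  [4]P≡O⇒[2]P-on-x-axis {x} {y} {L} y≢0 [4]P≡O = by-cases (x ≟ x₃)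
    where
      open ≡-Reasoning
      x₃ = L * L - x - x
      y₃ = L * (x - x₃) - y

      by-cases : Dec (x ≡ x₃) → L * (x - x₃) ≡ y
      by-cases (yes x≡x₃) = ⊥-elim (pt≢O (trans (sym (cong (pt x y ⊕_) (⊕-inverse x≡x₃ y+y₃≡0))) [4]P≡O))
        where
          y+y₃≡0 : y + y₃ ≡ 0#
          y+y₃≡0 = trans (cong (λ z → y + (L * (x - z) - y)) (sym x≡x₃))
            (solve 3 (λ y L x → y :+ (L :* (x :- x) :- y) := con (ℤ.+ 0)) refl y L x)
      by-cases (no x≢x₃) = [ chord-slope≡L , ⊥-elim ∘ chord-slope≢-L ]′ (x*x≡y*y⇒x≡±y μ L μ*μ≡L*L)
        where
          μ = (y₃ - y) / (x₃ - x)
          chord : y₃ - y ≡ μ * (x₃ - x)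
          chord = sym (x/y*y≡x _ (x-y≢0 (x≢x₃ ∘ sym)))
          x≡x₄ : x ≡ μ * μ - x - x₃
          x≡x₄ = proj₁ (⊕≡O⇒ _ _ _ _ (subst (λ Q → pt x y ⊕ Q ≡ O) (⊕-chord μ x≢x₃ chord) [4]P≡O))
          μ*μ≡L*L : μ * μ ≡ L * L
          μ*μ≡L*L = begin
            μ * μ                      ≡⟨ solve 3 (λ m x w → m :* m := (m :* m :- x :- w) :+ x :+ w) refl μ x x₃ ⟩
            (μ * μ - x - x₃) + x + x₃  ≡⟨ cong (λ z → z + x + x₃) x≡x₄ ⟨
            x + x + x₃                 ≡⟨ solve 2 (λ x L → x :+ x :+ (L :* L :- x :- x) := L :* L) refl x L ⟩
            L * L                      ∎
          chord-slope≢-L : ¬ μ ≡ - L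
          chord-slope≢-L μ≡-L = y+y≢0 y≢0 (begin
            y + y                        ≡⟨ solve 4 (λ y L x w → y :+ y := (:- L) :* (w :- x) :- ((L :* (x :- w) :- y) :- y)) refl y L x x₃ ⟩
            (- L) * (x₃ - x) - (y₃ - y)  ≡⟨ cong (λ z → z * (x₃ - x) - (y₃ - y)) μ≡-L ⟨
            μ * (x₃ - x) - (y₃ - y)      ≡⟨ cong (λ z → μ * (x₃ - x) - z) chord ⟩
            μ * (x₃ - x) - μ * (x₃ - x)  ≡⟨ -‿inverseʳ _ ⟩
            0#                           ∎)
          chord-slope≡L : μ ≡ L → L * (x - x₃) ≡ y
          chord-slope≡L μ≡L = x∙y⁻¹≈ε⇒x≈y _ _ ([ ⊥-elim ∘ 2≢0 , id ]′ (x*y≡0⇒x≡0⊎y≡0 (ι 2) y₃ (begin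
            ι 2 * y₃                 ≡⟨ solve 4 (λ y L x w → con (ℤ.+ 2) :* (L :* (x :- w) :- y) := ((L :* (x :- w) :- y) :- y) :- L :* (w :- x)) refl y L x x₃ ⟩
            (y₃ - y) - L * (x₃ - x)  ≡⟨ cong (λ z → (y₃ - y) - z * (x₃ - x)) μ≡L ⟨
            (y₃ - y) - μ * (x₃ - x)  ≡⟨ x≈y⇒x∙y⁻¹≈ε chord ⟩
            0#                       ∎)))

  order4⇒halving : HasPointOfOrder4 → ∃[ e ] f e ≡ 0# × Halving e
  order4⇒halving (O , _ , _ , [2]O≢O) = ⊥-elim ([2]O≢O refl)
  order4⇒halving (pt x y , on-curve , [4]P≡O , [2]P≢O) =
    L * L - x - x , tangent-to-root⇒halving on-curve y≢0 tangent
      ([4]P≡O⇒[2]P-on-x-axis y≢0 (subst (λ Q → pt x y ⊕ (pt x y ⊕ Q) ≡ O) (⊕-double L y≢0 tangent) [4]P≡O))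
    where
      y≢0 : ¬ y ≡ 0#
      y≢0 y≡0 = [2]P≢O (⊕-inverse refl (trans (cong₂ _+_ y≡0 y≡0) (+-identityˡ 0#)))
      L = f′ x / (ι 2 * y)
      tangent : f′ x ≡ L * (ι 2 * y)
      tangent = sym (x/y*y≡x (f′ x) (*-≢0 2≢0 y≢0))

module CubicRoots (F : FiniteField) (1+1≢0 : OddCharacteristic F) (A B : FiniteField.Carrier F) where

  open FieldFacts F
  open QuadraticCharacter F 1+1≢0
  open Curve F A B
  open CurveFacts F 1+1≢0 A B

  cofactor : Carrier → Carrier → Carrier
  cofactor e X = X * X + e * X + (e * e + A)

  f≡[X-e]*cofactor+f[e] : ∀ e X → f X ≡ (X - e) * cofactor e X + f e
  f≡[X-e]*cofactor+f[e] e X = solve 4 (λ e X A B → X :* X :* X :+ A :* X :+ B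
    := (X :- e) :* (X :* X :+ e :* X :+ (e :* e :+ A)) :+ (e :* e :* e :+ A :* e :+ B)) refl e X A B

  cofactor-root : ∀ {e r} → f e ≡ 0# → f r ≡ 0# → ¬ r ≡ e → cofactor e r ≡ 0#
  cofactor-root {e} {r} fe≡0 fr≡0 r≢e = [ ⊥-elim ∘ x-y≢0 r≢e , id ]′ (x*y≡0⇒x≡0⊎y≡0 (r - e) (cofactor e r) (begin
    (r - e) * cofactor e r        ≡⟨ +-identityʳ _ ⟨
    (r - e) * cofactor e r + 0#   ≡⟨ cong ((r - e) * cofactor e r +_) fe≡0 ⟨
    (r - e) * cofactor e r + f e  ≡⟨ f≡[X-e]*cofactor+f[e] e r ⟨
    f r                           ≡⟨ fr≡0 ⟩
    0#                            ∎))
    where open ≡-Reasoning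

  cofactor-root⇒root : ∀ {e r} → f e ≡ 0# → cofactor e r ≡ 0# → f r ≡ 0#
  cofactor-root⇒root {e} {r} fe≡0 cofactor≡0 = begin
    f r                                 ≡⟨ f≡[X-e]*cofactor+f[e] e r ⟩
    (r - e) * cofactor e r + f e        ≡⟨ cong₂ (λ a b → (r - e) * a + b) cofactor≡0 fe≡0 ⟩
    (r - e) * 0# + 0#                   ≡⟨ solve 1 (λ u → u :* con (ℤ.+ 0) :+ con (ℤ.+ 0) := con (ℤ.+ 0)) refl (r - e) ⟩
    0#                                  ∎
    where open ≡-Reasoning

  cofactor≡[X-r]*[X-r′] : ∀ e r X → cofactor e X ≡ (X - r) * (X - (- e - r)) + cofactor e r
  cofactor≡[X-r]*[X-r′] e r X = solve 4 (λ e r X A → X :* X :+ e :* X :+ (e :* e :+ A)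
    := (X :- r) :* (X :- (:- e :- r)) :+ (r :* r :+ e :* r :+ (e :* e :+ A))) refl e r X A

  roots-of-f : ∀ {e r x} → f e ≡ 0# → cofactor e r ≡ 0# → f x ≡ 0# → x ≡ e ⊎ x ≡ r ⊎ x ≡ - e - r
  roots-of-f {e} {r} {x} fe≡0 cofactor≡0 fx≡0 with x ≟ e
  ... | yes x≡e = inj₁ x≡e
  ... | no x≢e = inj₂ (Data.Sum.map (x∙y⁻¹≈ε⇒x≈y x r) (x∙y⁻¹≈ε⇒x≈y x (- e - r))
    (x*y≡0⇒x≡0⊎y≡0 (x - r) (x - (- e - r)) (begin
      (x - r) * (x - (- e - r))               ≡⟨ +-identityʳ _ ⟨
      (x - r) * (x - (- e - r)) + 0#          ≡⟨ cong ((x - r) * (x - (- e - r)) +_) cofactor≡0 ⟨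
      (x - r) * (x - (- e - r)) + cofactor e r ≡⟨ cofactor≡[X-r]*[X-r′] e r x ⟨
      cofactor e x                            ≡⟨ cofactor-root fe≡0 fx≡0 x≢e ⟩
      0#                                      ∎)))
    where open ≡-Reasoning

  numRoots≡length : ∀ {xs} → Unique xs → (∀ {x} → x ∈ xs ⇔ f x ≡ 0#) → numRoots ≡ length xs
  numRoots≡length {xs} xs-unique ∈xs⇔root = ↭-length (∼bag⇒↭ (unique∧set⇒bag
    (Unique.filter⁺ (λ x → f x ≟ 0#) {elements} elements-unique) xs-unique
    (λ {x} → mk⇔ (Equivalence.from ∈xs⇔root ∘ proj₂ ∘ ∈-filter⁻ (λ x → f x ≟ 0#) {xs = elements})
                 (∈-filter⁺ (λ x → f x ≟ 0#) (∈-elements x) ∘ Equivalence.to ∈xs⇔root))))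


  numRoots≡1 : ∀ {e} → f e ≡ 0# → (∀ r → ¬ cofactor e r ≡ 0#) → numRoots ≡ 1
  numRoots≡1 {e} fe≡0 no-cofactor-root = numRoots≡length ([] ∷ []) (mk⇔ (λ { (here refl) → fe≡0 }) root⇒≡e)
    where
      root⇒≡e : ∀ {x} → f x ≡ 0# → x ∈ e ∷ []
      root⇒≡e {x} fx≡0 with x ≟ e
      ... | yes x≡e = here x≡e
      ... | no x≢e  = ⊥-elim (no-cofactor-root x (cofactor-root fe≡0 fx≡0 x≢e))

  cofactor[e,e]≡f′e : ∀ e → cofactor e e ≡ f′ e
  cofactor[e,e]≡f′e e = solve 2 (λ e A → e :* e :+ e :* e :+ (e :* e :+ A) := con (ℤ.+ 3) :* (e :* e) :+ A) refl e A

  numRoots≡3 : ∀ {e r} → Nonsingular → f e ≡ 0# → cofactor e r ≡ 0# → numRoots ≡ 3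
  numRoots≡3 {e} {r} nonsingular fe≡0 cofactor≡0 =
    numRoots≡length ((e≢r ∷ e≢r′ ∷ []) ∷ (r≢r′ ∷ []) ∷ [] ∷ []) (mk⇔ ∈⇒root root⇒∈)
    where
      r′ = - e - r
      cofactor[e,r′]≡0 : cofactor e r′ ≡ 0#
      cofactor[e,r′]≡0 = trans (solve 3 (λ e r A → let r′ = :- e :- r in r′ :* r′ :+ e :* r′ :+ (e :* e :+ A)
        := r :* r :+ e :* r :+ (e :* e :+ A)) refl e r A) cofactor≡0
      cofactor-root≢e : ∀ {z} → cofactor e z ≡ 0# → ¬ e ≡ z
      cofactor-root≢e cofactor≡0 e≡z = f≡0∧f′≡0⇒singular fe≡0
        (trans (sym (cofactor[e,e]≡f′e e)) (trans (cong (cofactor e) e≡z) cofactor≡0)) nonsingular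
      e≢r = cofactor-root≢e cofactor≡0
      e≢r′ = cofactor-root≢e cofactor[e,r′]≡0
      r≢r′ : ¬ r ≡ r′
      r≢r′ r≡r′ = f≡0∧f′≡0⇒singular (cofactor-root⇒root fe≡0 cofactor≡0) (begin
        f′ r                                       ≡⟨ solve 3 (λ e r A → con (ℤ.+ 3) :* (r :* r) :+ A
                                                        := (r :* r :+ e :* r :+ (e :* e :+ A)) :+ (r :- e) :* (r :- (:- e :- r))) refl e r A ⟩
        cofactor e r + (r - e) * (r - r′)          ≡⟨ cong₂ (λ a b → a + (r - e) * b) cofactor≡0 (x≈y⇒x∙y⁻¹≈ε r≡r′) ⟩
        0# + (r - e) * 0#                          ≡⟨ solve 1 (λ u → con (ℤ.+ 0) :+ u :* con (ℤ.+ 0) := con (ℤ.+ 0)) refl (r - e) ⟩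
        0#                                         ∎) nonsingular
        where open ≡-Reasoning
      ∈⇒root : ∀ {x} → x ∈ e ∷ r ∷ r′ ∷ [] → f x ≡ 0#
      ∈⇒root (here refl)                 = fe≡0
      ∈⇒root (there (here refl))         = cofactor-root⇒root fe≡0 cofactor≡0
      ∈⇒root (there (there (here refl))) = cofactor-root⇒root fe≡0 cofactor[e,r′]≡0
      root⇒∈ : ∀ {x} → f x ≡ 0# → x ∈ e ∷ r ∷ r′ ∷ []
      root⇒∈ fx≡0 = [ here , [ there ∘ here , there ∘ there ∘ here ]′ ]′ (roots-of-f fe≡0 cofactor≡0 fx≡0)

  -- f = (X - e₁) (X - e₂) (X - e₃), read off from the coefficients of X² and X.
  record Splits (e₁ e₂ e₃ : Carrier) : Set where
    field
      e₃≡-e₁-e₂ : e₃ ≡ - e₁ - e₂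
      A≡        : A ≡ - (e₁ * e₁ + e₁ * e₂ + e₂ * e₂)

  splits-swap : ∀ {e₁ e₂ e₃} → Splits e₁ e₂ e₃ → Splits e₂ e₁ e₃
  splits-swap {e₁} {e₂} sp = record
    { e₃≡-e₁-e₂ = trans e₃≡-e₁-e₂ (solve 2 (λ a b → :- a :- b := :- b :- a) refl e₁ e₂)
    ; A≡        = trans A≡ (solve 2 (λ a b → :- (a :* a :+ a :* b :+ b :* b) := :- (b :* b :+ b :* a :+ a :* a)) refl e₁ e₂)
    }
    where open Splits sp

  splits-rotate : ∀ {e₁ e₂ e₃} → Splits e₁ e₂ e₃ → Splits e₃ e₁ e₂
  splits-rotate {e₁} {e₂} {e₃} sp = record
    { e₃≡-e₁-e₂ = trans (solve 2 (λ a b → b := :- (:- a :- b) :- a) refl e₁ e₂) (cong (λ z → - z - e₁) (sym e₃≡-e₁-e₂))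
    ; A≡        = trans A≡ (trans (solve 2 (λ a b → let c = :- a :- b in :- (a :* a :+ a :* b :+ b :* b) := :- (c :* c :+ c :* a :+ a :* a)) refl e₁ e₂)
                    (cong (λ z → - (z * z + z * e₁ + e₁ * e₁)) (sym e₃≡-e₁-e₂)))
    }
    where open Splits sp

  three-roots⇒splits : ∀ {e₁ e₂ e₃} → f e₁ ≡ 0# → f e₂ ≡ 0# → f e₃ ≡ 0# →
    ¬ e₂ ≡ e₁ → ¬ e₃ ≡ e₁ → ¬ e₂ ≡ e₃ → Splits e₁ e₂ e₃
  three-roots⇒splits {e₁} {e₂} {e₃} fe₁≡0 fe₂≡0 fe₃≡0 e₂≢e₁ e₃≢e₁ e₂≢e₃ = record
    { e₃≡-e₁-e₂ = [ ⊥-elim ∘ x-y≢0 e₂≢e₃ , sum≡0⇒ ]′ (x*y≡0⇒x≡0⊎y≡0 (e₂ - e₃) (e₂ + e₃ + e₁) (begin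
        (e₂ - e₃) * (e₂ + e₃ + e₁)              ≡⟨ solve 4 (λ a b c A → (b :- c) :* (b :+ c :+ a)
                                                     := (b :* b :+ a :* b :+ (a :* a :+ A)) :- (c :* c :+ a :* c :+ (a :* a :+ A))) refl e₁ e₂ e₃ A ⟩
        cofactor e₁ e₂ - cofactor e₁ e₃         ≡⟨ cong₂ _-_ cofactor₂≡0 cofactor₃≡0 ⟩
        0# - 0#                                 ≡⟨ -‿inverseʳ 0# ⟩
        0#                                      ∎))
    ; A≡ = begin
        A                                                ≡⟨ solve 3 (λ a b A → A := (b :* b :+ a :* b :+ (a :* a :+ A)) :- (b :* b :+ a :* b :+ a :* a)) refl e₁ e₂ A ⟩
        cofactor e₁ e₂ - (e₂ * e₂ + e₁ * e₂ + e₁ * e₁)   ≡⟨ cong (_- (e₂ * e₂ + e₁ * e₂ + e₁ * e₁)) cofactor₂≡0 ⟩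
        0# - (e₂ * e₂ + e₁ * e₂ + e₁ * e₁)               ≡⟨ solve 2 (λ a b → con (ℤ.+ 0) :- (b :* b :+ a :* b :+ a :* a) := :- (a :* a :+ a :* b :+ b :* b)) refl e₁ e₂ ⟩
        - (e₁ * e₁ + e₁ * e₂ + e₂ * e₂)                  ∎
    }
    where
      open ≡-Reasoning
      cofactor₂≡0 = cofactor-root fe₁≡0 fe₂≡0 e₂≢e₁
      cofactor₃≡0 = cofactor-root fe₁≡0 fe₃≡0 e₃≢e₁
      sum≡0⇒ : e₂ + e₃ + e₁ ≡ 0# → e₃ ≡ - e₁ - e₂
      sum≡0⇒ sum≡0 = begin
        e₃                      ≡⟨ solve 3 (λ a b c → c := (b :+ c :+ a) :- a :- b) refl e₁ e₂ e₃ ⟩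
        (e₂ + e₃ + e₁) - e₁ - e₂ ≡⟨ cong (λ z → z - e₁ - e₂) sum≡0 ⟩
        0# - e₁ - e₂            ≡⟨ solve 2 (λ a b → con (ℤ.+ 0) :- a :- b := :- a :- b) refl e₁ e₂ ⟩
        - e₁ - e₂               ∎

  f′≡product : ∀ {e₁ e₂ e₃} → Splits e₁ e₂ e₃ → f′ e₁ ≡ (e₁ - e₂) * (e₁ - e₃)
  f′≡product {e₁} {e₂} {e₃} sp = begin
    ι 3 * (e₁ * e₁) + A                              ≡⟨ cong (ι 3 * (e₁ * e₁) +_) A≡ ⟩
    ι 3 * (e₁ * e₁) + - (e₁ * e₁ + e₁ * e₂ + e₂ * e₂) ≡⟨ solve 2 (λ a b → con (ℤ.+ 3) :* (a :* a) :+ :- (a :* a :+ a :* b :+ b :* b)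
                                                          := (a :- b) :* (a :- (:- a :- b))) refl e₁ e₂ ⟩
    (e₁ - e₂) * (e₁ - (- e₁ - e₂))                   ≡⟨ cong (λ z → (e₁ - e₂) * (e₁ - z)) e₃≡-e₁-e₂ ⟨
    (e₁ - e₂) * (e₁ - e₃)                            ∎
    where
      open ≡-Reasoning
      open Splits sp

  -- With u = e₁ - e₂ and v = e₁ - e₃ one has f′ e₁ = u v and 3 e₁ + 2 s = u + v + 2 s;
  -- so s² = u v gives (3 e₁ + 2 s) u = (u + s)², while u = a², v = b² gives s = a b, l = a ± b.
  halving⇔squares : ∀ {e₁ e₂ e₃} → Splits e₁ e₂ e₃ → ¬ e₁ ≡ e₂ →
    Halving e₁ ⇔ (IsSquare (e₁ - e₂) × IsSquare (e₁ - e₃))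
  halving⇔squares {e₁} {e₂} {e₃} sp e₁≢e₂ = mk⇔ halving⇒squares squares⇒halving
    where
      open ≡-Reasoning
      u = e₁ - e₂
      v = e₁ - e₃
      f′e₁≡uv = f′≡product sp
      3e₁+2s≡u+v+2s : ∀ s → ι 3 * e₁ + ι 2 * s ≡ u + v + ι 2 * s
      3e₁+2s≡u+v+2s s = trans (solve 3 (λ a b s → con (ℤ.+ 3) :* a :+ con (ℤ.+ 2) :* s
                                   := (a :- b) :+ (a :- (:- a :- b)) :+ con (ℤ.+ 2) :* s) refl e₁ e₂ s)
                          (cong (λ z → u + (e₁ - z) + ι 2 * s) (sym (Splits.e₃≡-e₁-e₂ sp)))

      halving⇒squares : Halving e₁ → IsSquare u × IsSquare v
      halving⇒squares h =
        IsSquare-cancelˡ l≢0 (l*l*w≡[w+s]² u v refl uv≡ss) ,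
        IsSquare-cancelˡ l≢0 (l*l*w≡[w+s]² v u (+-comm u v) (trans (*-comm v u) uv≡ss))
        where
          open Halving h
          uv≡ss : u * v ≡ s * s
          uv≡ss = trans (sym f′e₁≡uv) (sym s*s≡f′e)
          l*l*w≡[w+s]² : ∀ w w′ → u + v ≡ w + w′ → w * w′ ≡ s * s → l * l * w ≡ (w + s) * (w + s)
          l*l*w≡[w+s]² w w′ u+v≡w+w′ ww′≡ss = begin
            l * l * w                      ≡⟨ cong (_* w) (trans l*l≡3e+2s (3e₁+2s≡u+v+2s s)) ⟩
            (u + v + ι 2 * s) * w          ≡⟨ cong (λ z → (z + ι 2 * s) * w) u+v≡w+w′ ⟩
            (w + w′ + ι 2 * s) * w         ≡⟨ solve 3 (λ w w′ s → (w :+ w′ :+ con (ℤ.+ 2) :* s) :* w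
                                                  := w :* w :+ w :* w′ :+ con (ℤ.+ 2) :* s :* w) refl w w′ s ⟩
            w * w + w * w′ + ι 2 * s * w   ≡⟨ cong (λ z → w * w + z + ι 2 * s * w) ww′≡ss ⟩
            w * w + s * s + ι 2 * s * w    ≡⟨ solve 2 (λ w s → w :* w :+ s :* s :+ con (ℤ.+ 2) :* s :* w := (w :+ s) :* (w :+ s)) refl w s ⟩
            (w + s) * (w + s)              ∎

      squares⇒halving : IsSquare u × IsSquare v → Halving e₁
      squares⇒halving ((a , aa≡u) , (b , bb≡v)) with (a + b) ≟ 0#
      ... | no a+b≢0 = record
        { s = a * b ; l = a + b
        ; s*s≡f′e = trans (solve 2 (λ a b → (a :* b) :* (a :* b) := (a :* a) :* (b :* b)) refl a b)
                      (trans (cong₂ _*_ aa≡u bb≡v) (sym f′e₁≡uv))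
        ; l*l≡3e+2s = trans (solve 2 (λ a b → (a :+ b) :* (a :+ b) := a :* a :+ b :* b :+ con (ℤ.+ 2) :* (a :* b)) refl a b)
                        (trans (cong₂ (λ x y → x + y + ι 2 * (a * b)) aa≡u bb≡v) (sym (3e₁+2s≡u+v+2s (a * b))))
        ; l≢0 = a+b≢0
        }
      ... | yes a+b≡0 = record
        { s = - (a * b) ; l = a - b
        ; s*s≡f′e = trans (solve 2 (λ a b → (:- (a :* b)) :* (:- (a :* b)) := (a :* a) :* (b :* b)) refl a b)
                      (trans (cong₂ _*_ aa≡u bb≡v) (sym f′e₁≡uv))
        ; l*l≡3e+2s = trans (solve 2 (λ a b → (a :- b) :* (a :- b) := a :* a :+ b :* b :+ con (ℤ.+ 2) :* (:- (a :* b))) refl a b)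
                        (trans (cong₂ (λ x y → x + y + ι 2 * (- (a * b))) aa≡u bb≡v) (sym (3e₁+2s≡u+v+2s (- (a * b)))))
        ; l≢0 = λ a-b≡0 → x-y≢0 e₁≢e₂ (trans (sym aa≡u) (trans (cong (_* a) (a≡0 a-b≡0)) (zeroˡ a)))
        }
        where
          a≡0 : a - b ≡ 0# → a ≡ 0#
          a≡0 a-b≡0 = [ ⊥-elim ∘ 2≢0 , id ]′ (x*y≡0⇒x≡0⊎y≡0 (ι 2) a (begin
            ι 2 * a            ≡⟨ solve 2 (λ a b → con (ℤ.+ 2) :* a := (a :+ b) :+ (a :- b)) refl a b ⟩
            (a + b) + (a - b)  ≡⟨ cong₂ _+_ a+b≡0 a-b≡0 ⟩
            0# + 0#            ≡⟨ +-identityˡ 0# ⟩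
            0#                 ∎))

  -- - 3 e² - 4 A is the discriminant of the quadratic cofactor e.
  cofactor-discriminant-nonsquare : ∀ {e} → (∀ r → ¬ cofactor e r ≡ 0#) → ¬ IsSquare (- (ι 3 * (e * e)) - ι 4 * A)
  cofactor-discriminant-nonsquare {e} no-cofactor-root (t , tt≡d) =
    no-cofactor-root r ([ ⊥-elim ∘ *-≢0 2≢0 2≢0 , id ]′ (x*y≡0⇒x≡0⊎y≡0 (ι 2 * ι 2) (cofactor e r) (begin
      ι 2 * ι 2 * cofactor e r                                        ≡⟨ solve 3 (λ e r A → con (ℤ.+ 2) :* con (ℤ.+ 2) :* (r :* r :+ e :* r :+ (e :* e :+ A))
                                                                            := (con (ℤ.+ 2) :* r) :* (con (ℤ.+ 2) :* r) :+ con (ℤ.+ 2) :* e :* (con (ℤ.+ 2) :* r)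
                                                                               :+ con (ℤ.+ 4) :* (e :* e :+ A)) refl e r A ⟩
      (ι 2 * r) * (ι 2 * r) + ι 2 * e * (ι 2 * r) + ι 4 * (e * e + A) ≡⟨ cong (λ z → z * z + ι 2 * e * z + ι 4 * (e * e + A)) 2r≡t-e ⟩
      (t - e) * (t - e) + ι 2 * e * (t - e) + ι 4 * (e * e + A)       ≡⟨ solve 3 (λ t e A → (t :- e) :* (t :- e) :+ con (ℤ.+ 2) :* e :* (t :- e) :+ con (ℤ.+ 4) :* (e :* e :+ A)
                                                                            := t :* t :- (:- (con (ℤ.+ 3) :* (e :* e)) :- con (ℤ.+ 4) :* A)) refl t e A ⟩
      t * t - (- (ι 3 * (e * e)) - ι 4 * A)                           ≡⟨ x≈y⇒x∙y⁻¹≈ε tt≡d ⟩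
      0#                                                              ∎)))
    where
      open ≡-Reasoning
      r = (t - e) / ι 2
      2r≡t-e : ι 2 * r ≡ t - e
      2r≡t-e = trans (*-comm _ _) (x/y*y≡x (t - e) 2≢0)

  halving⇔f′-square : Nonsingular → ∀ {e} → f e ≡ 0# → (∀ r → ¬ cofactor e r ≡ 0#) → Halving e ⇔ IsSquare (f′ e)
  halving⇔f′-square nonsingular {e} fe≡0 no-cofactor-root = mk⇔ (λ h → Halving.s h , Halving.s*s≡f′e h) square⇒halving
    where
      l² : Carrier → Carrier
      l² s = ι 3 * e + ι 2 * s

      square⇒halving : IsSquare (f′ e) → Halving e
      square⇒halving (s , ss≡f′e) = by-cases (isSquare? (l² s)) refl (isSquare? (l² (- s))) refl
        where
          open ≡-Reasoning
          d = - (ι 3 * (e * e)) - ι 4 * A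
          d-nonsquare = cofactor-discriminant-nonsquare no-cofactor-root
          l²₊l²₋≡d : l² s * l² (- s) ≡ d
          l²₊l²₋≡d = begin
            l² s * l² (- s)                                  ≡⟨ solve 2 (λ e s → (con (ℤ.+ 3) :* e :+ con (ℤ.+ 2) :* s) :* (con (ℤ.+ 3) :* e :+ con (ℤ.+ 2) :* (:- s))
                                                                 := con (ℤ.+ 9) :* (e :* e) :- con (ℤ.+ 4) :* (s :* s)) refl e s ⟩
            ι 9 * (e * e) - ι 4 * (s * s)                  ≡⟨ cong (λ z → ι 9 * (e * e) - ι 4 * z) ss≡f′e ⟩
            ι 9 * (e * e) - ι 4 * (ι 3 * (e * e) + A)      ≡⟨ solve 2 (λ e A → con (ℤ.+ 9) :* (e :* e) :- con (ℤ.+ 4) :* (con (ℤ.+ 3) :* (e :* e) :+ A)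
                                                                 := :- (con (ℤ.+ 3) :* (e :* e)) :- con (ℤ.+ 4) :* A) refl e A ⟩
            d                                              ∎
          l²₊l²₋≢0 : ¬ l² s * l² (- s) ≡ 0#
          l²₊l²₋≢0 l²₊l²₋≡0 = d-nonsquare (0# , trans (zeroˡ 0#) (sym (trans (sym l²₊l²₋≡d) l²₊l²₋≡0)))
          l²₊≢0 : ¬ l² s ≡ 0#
          l²₊≢0 l²₊≡0 = l²₊l²₋≢0 (trans (cong (_* l² (- s)) l²₊≡0) (zeroˡ _))
          l²₋≢0 : ¬ l² (- s) ≡ 0#
          l²₋≢0 l²₋≡0 = l²₊l²₋≢0 (trans (cong (l² s *_) l²₋≡0) (zeroʳ _))

          from-root : ∀ {σ} → σ * σ ≡ f′ e → isSquare? (l² σ) ≡ true → ¬ l² σ ≡ 0# → Halving e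
          from-root {σ} σσ≡f′e □l² □l²≢0 = record
            { s = σ ; l = proj₁ (isSquare?-sound _ □l²) ; s*s≡f′e = σσ≡f′e ; l*l≡3e+2s = proj₂ (isSquare?-sound _ □l²)
            ; l≢0 = square-root-≢0 □l²≢0 (proj₂ (isSquare?-sound _ □l²)) }

          -- l² s * l² (- s) = d is a nonsquare, so exactly one of l² (± s) is a square.
          by-cases : ∀ b₊ → isSquare? (l² s) ≡ b₊ → ∀ b₋ → isSquare? (l² (- s)) ≡ b₋ → Halving e
          by-cases true  □l²₊ _     _   = from-root ss≡f′e □l²₊ l²₊≢0
          by-cases false _   true  □l²₋ = from-root (trans (solve 1 (λ s → (:- s) :* (:- s) := s :* s) refl s) ss≡f′e) □l²₋ l²₋≢0
          by-cases false □l²₊ false □l²₋ = ⊥-elim (d-nonsquare (subst IsSquare l²₊l²₋≡d (isSquare?-sound _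
            (trans (isSquare?-* l²₊≢0 l²₋≢0) (cong₂ _≡ᵇ_ □l²₊ □l²₋)))))

  order4⇔halving : Nonsingular → HasPointOfOrder4 ⇔ (∃[ e ] f e ≡ 0# × Halving e)
  order4⇔halving nonsingular = mk⇔ order4⇒halving (λ (_ , fe≡0 , h) → halving⇒order4 nonsingular fe≡0 h)

Conclusion : (F : FiniteField) → (A B x₀ x₁ x₂ : FiniteField.Carrier F) → Set
Conclusion F A B x₀ x₁ x₂ =
    let open FiniteField F in
    let open Curve F A B in
    (card % 4 ≡ 3 →
      (χ (f′ x₀) ≡ 1ℤ → HasPointOfOrder4)
      × (¬ χ (f′ x₀) ≡ 1ℤ →
          (HasPointOfOrder4 ⇔ ((numRoots ≡ 3) × (χ (f′ x₁) ≡ 1ℤ)))))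
    ×
    (card % 4 ≡ 1 →
      (numRoots ≡ 1 → (HasPointOfOrder4 ⇔ (χ (f′ x₀) ≡ 1ℤ)))
      × (¬ numRoots ≡ 1 →
          (χ (f′ x₀) ≡ 1ℤ → (HasPointOfOrder4 ⇔ (χ (x₀ - x₁) ≡ 1ℤ)))
          × (χ (f′ x₀) ≡ -1ℤ → (HasPointOfOrder4 ⇔ (χ (x₁ - x₂) ≡ 1ℤ)))))

-- p, q, r say whether x₀ - x₁, x₀ - x₂, x₁ - x₂ are squares and m whether -1 is;
-- the three disjuncts say that x₀, x₁, x₂ respectively admit a halving.
someRootHalves : Bool → Bool → Bool → Bool → Bool
someRootHalves p q r m = p ∧ q ∨ (m ≡ᵇ p) ∧ r ∨ (m ≡ᵇ q) ∧ (m ≡ᵇ r)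

≡ᵇ≡true⇒≡ : ∀ a b → (a ≡ᵇ b) ≡ true → b ≡ a
≡ᵇ≡true⇒≡ true  true  _ = refl
≡ᵇ≡true⇒≡ false false _ = refl

≡ᵇ≡false⇒≡not : ∀ a b → (a ≡ᵇ b) ≡ false → b ≡ not a
≡ᵇ≡false⇒≡not true  false _ = refl
≡ᵇ≡false⇒≡not false true  _ = refl

someRootHalves[p,p,r,true] : ∀ p r → someRootHalves p p r true ≡ p
someRootHalves[p,p,r,true] true  _ = refl
someRootHalves[p,p,r,true] false r = refl

someRootHalves[p,¬p,r,true] : ∀ p r → someRootHalves p (not p) r true ≡ r
someRootHalves[p,¬p,r,true] true  true  = refl
someRootHalves[p,¬p,r,true] true  false = refl
someRootHalves[p,¬p,r,true] false true  = refl
someRootHalves[p,¬p,r,true] false false = refl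

someRootHalves[p,p,r,false] : ∀ p r → someRootHalves p p r false ≡ true
someRootHalves[p,p,r,false] true  _     = refl
someRootHalves[p,p,r,false] false true  = refl
someRootHalves[p,p,r,false] false false = refl

someRootHalves[p,¬p,r,false] : ∀ p r → someRootHalves p (not p) r false ≡ (not p ≡ᵇ r)
someRootHalves[p,¬p,r,false] true  true  = refl
someRootHalves[p,¬p,r,false] true  false = refl
someRootHalves[p,¬p,r,false] false true  = refl
someRootHalves[p,¬p,r,false] false false = refl

module Cases (F : FiniteField) (1+1≢0 : OddCharacteristic F) (A B : FiniteField.Carrier F) where

  open FieldFacts F
  open QuadraticCharacter F 1+1≢0
  open Curve F A B
  open CurveFacts F 1+1≢0 A B
  open CubicRoots F 1+1≢0 A B

  one-root : Nonsingular → ∀ {x₀} x₁ x₂ → f x₀ ≡ 0# → (∀ r → ¬ cofactor x₀ r ≡ 0#) → Conclusion F A B x₀ x₁ x₂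
  one-root nonsingular {x₀} x₁ x₂ fx₀≡0 no-cofactor-root =
    (λ _ → order4⇐χ≡1 , λ χ≢1 → mk⇔ (⊥-elim ∘ χ≢1 ∘ order4⇒χ≡1) (λ (n≡3 , _) → ⊥-elim (1≢3 (trans (sym n≡1) n≡3)))) ,
    (λ _ → (λ _ → mk⇔ order4⇒χ≡1 order4⇐χ≡1) , λ n≢1 → ⊥-elim (n≢1 n≡1))
    where
      n≡1 = numRoots≡1 fx₀≡0 no-cofactor-root
      1≢3 : ¬ 1 ≡ 3
      1≢3 ()
      f′x₀≢0 : ¬ f′ x₀ ≡ 0#
      f′x₀≢0 f′x₀≡0 = f≡0∧f′≡0⇒singular fx₀≡0 f′x₀≡0 nonsingular

      order4⇔square : HasPointOfOrder4 ⇔ IsSquare (f′ x₀)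
      order4⇔square = mk⇔
        (λ order4 → let e , fe≡0 , h = Equivalence.to (order4⇔halving nonsingular) order4 in
          Equivalence.to (halving⇔f′-square nonsingular fx₀≡0 no-cofactor-root) (subst Halving (root≡x₀ fe≡0) h))
        (λ □f′x₀ → Equivalence.from (order4⇔halving nonsingular)
          (x₀ , fx₀≡0 , Equivalence.from (halving⇔f′-square nonsingular fx₀≡0 no-cofactor-root) □f′x₀))
        where
          root≡x₀ : ∀ {e} → f e ≡ 0# → e ≡ x₀
          root≡x₀ {e} fe≡0 with e ≟ x₀
          ... | yes e≡x₀ = e≡x₀
          ... | no e≢x₀  = ⊥-elim (no-cofactor-root e (cofactor-root fx₀≡0 fe≡0 e≢x₀))

      order4⇒χ≡1 : HasPointOfOrder4 → χ (f′ x₀) ≡ 1ℤ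
      order4⇒χ≡1 = Equivalence.from (χ≡1⇔isSquare? f′x₀≢0) ∘ isSquare?-complete _ ∘ Equivalence.to order4⇔square

      order4⇐χ≡1 : χ (f′ x₀) ≡ 1ℤ → HasPointOfOrder4
      order4⇐χ≡1 = Equivalence.from order4⇔square ∘ isSquare?-sound _ ∘ Equivalence.to (χ≡1⇔isSquare? f′x₀≢0)

  ¬χ≡1⇒isSquare?≡false : ∀ {a} → ¬ a ≡ 0# → ¬ χ a ≡ 1ℤ → isSquare? a ≡ false
  ¬χ≡1⇒isSquare?≡false {a} a≢0 χ≢1 = ¬IsSquare⇒isSquare?≡false a (χ≢1 ∘ Equivalence.from (χ≡1⇔isSquare? a≢0) ∘ isSquare?-complete a)

  χ≡1⇔T : ∀ {a} → ¬ a ≡ 0# → ∀ {b} → isSquare? a ≡ b → (χ a ≡ 1ℤ) ⇔ T b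
  χ≡1⇔T a≢0 refl = ⇔-trans (χ≡1⇔isSquare? a≢0) (⇔-sym T-≡)

  IsSquare⇔T : ∀ a → IsSquare a ⇔ T (isSquare? a)
  IsSquare⇔T a = ⇔-trans (mk⇔ (isSquare?-complete a) (isSquare?-sound a)) (⇔-sym T-≡)

  isSquare?-swap : ∀ {a b} → ¬ a ≡ b → isSquare? (b - a) ≡ (isSquare? (- 1#) ≡ᵇ isSquare? (a - b))
  isSquare?-swap {a} {b} a≢b = trans (cong isSquare? (solve 2 (λ a b → b :- a := :- (a :- b)) refl a b)) (isSquare?-neg (x-y≢0 a≢b))

  halves : ∀ {e₁ e₂ e₃} → Splits e₁ e₂ e₃ → ¬ e₁ ≡ e₂ → Halving e₁ ⇔ T (isSquare? (e₁ - e₂) ∧ isSquare? (e₁ - e₃))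
  halves sp e₁≢e₂ = ⇔-trans (halving⇔squares sp e₁≢e₂) (⇔-trans (IsSquare⇔T _ ×-⇔ IsSquare⇔T _) (⇔-sym T-∧))

  order4⇔someRootHalves : Nonsingular → ∀ {x₀ x₁ x₂} → f x₀ ≡ 0# → f x₁ ≡ 0# → f x₂ ≡ 0# →
    ¬ x₁ ≡ x₀ → ¬ x₂ ≡ x₀ → ¬ x₁ ≡ x₂ →
    HasPointOfOrder4 ⇔ T (someRootHalves (isSquare? (x₀ - x₁)) (isSquare? (x₀ - x₂)) (isSquare? (x₁ - x₂)) (isSquare? (- 1#)))
  order4⇔someRootHalves nonsingular {x₀} {x₁} {x₂} fx₀≡0 fx₁≡0 fx₂≡0 x₁≢x₀ x₂≢x₀ x₁≢x₂ = begin
    HasPointOfOrder4                                  ∼⟨ order4⇔halving nonsingular ⟩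
    (∃[ e ] f e ≡ 0# × Halving e)                     ∼⟨ some-root-halves ⟩
    (Halving x₀ ⊎ Halving x₁ ⊎ Halving x₂)            ∼⟨ halves sp₀ (x₁≢x₀ ∘ sym) ⊎-⇔ halves (splits-swap sp₀) x₁≢x₀
                                                           ⊎-⇔ halves (splits-rotate sp₀) x₂≢x₀ ⟩
    (T (p ∧ q) ⊎ T (isSquare? (x₁ - x₀) ∧ r) ⊎ T (isSquare? (x₂ - x₀) ∧ isSquare? (x₂ - x₁)))
                                                      ∼⟨ ⇔-sym (⇔-trans T-∨ (⇔-refl ⊎-⇔ T-∨)) ⟩
    T (p ∧ q ∨ isSquare? (x₁ - x₀) ∧ r ∨ isSquare? (x₂ - x₀) ∧ isSquare? (x₂ - x₁))
                                                      ≡⟨ cong T signs ⟩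
    T (someRootHalves p q r m)                        ∎
    where
      open EquationalReasoning {k = equivalence}
      sp₀ = three-roots⇒splits fx₀≡0 fx₁≡0 fx₂≡0 x₁≢x₀ x₂≢x₀ x₁≢x₂
      p = isSquare? (x₀ - x₁)
      q = isSquare? (x₀ - x₂)
      r = isSquare? (x₁ - x₂)
      m = isSquare? (- 1#)

      root-cases : ∀ {e} → f e ≡ 0# → e ≡ x₀ ⊎ e ≡ x₁ ⊎ e ≡ x₂
      root-cases fe≡0 = Data.Sum.map₂ (Data.Sum.map₂ (λ e≡ → trans e≡ (sym (Splits.e₃≡-e₁-e₂ sp₀))))
        (roots-of-f fx₀≡0 (cofactor-root fx₀≡0 fx₁≡0 x₁≢x₀) fe≡0)

      some-root-halves : (∃[ e ] f e ≡ 0# × Halving e) ⇔ (Halving x₀ ⊎ Halving x₁ ⊎ Halving x₂)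
      some-root-halves = mk⇔
        (λ (e , fe≡0 , h) → [ (λ e≡x₀ → inj₁ (subst Halving e≡x₀ h))
                            , [ (λ e≡x₁ → inj₂ (inj₁ (subst Halving e≡x₁ h))) , (λ e≡x₂ → inj₂ (inj₂ (subst Halving e≡x₂ h))) ]′ ]′
                            (root-cases fe≡0))
        [ (x₀ ,_) ∘ (fx₀≡0 ,_) , [ (x₁ ,_) ∘ (fx₁≡0 ,_) , (x₂ ,_) ∘ (fx₂≡0 ,_) ]′ ]′

      signs : (p ∧ q ∨ isSquare? (x₁ - x₀) ∧ r ∨ isSquare? (x₂ - x₀) ∧ isSquare? (x₂ - x₁)) ≡ someRootHalves p q r m
      signs = cong₂ (λ a bc → p ∧ q ∨ a ∧ r ∨ bc) (isSquare?-swap (x₁≢x₀ ∘ sym))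
                (cong₂ _∧_ (isSquare?-swap (x₂≢x₀ ∘ sym)) (isSquare?-swap x₁≢x₂))

  three-roots : Nonsingular → ∀ {x₀ x₁ x₂} → f x₀ ≡ 0# → f x₁ ≡ 0# → f x₂ ≡ 0# →
    ¬ x₁ ≡ x₀ → ¬ x₂ ≡ x₀ → ¬ x₁ ≡ x₂ → Conclusion F A B x₀ x₁ x₂
  three-roots nonsingular {x₀} {x₁} {x₂} fx₀≡0 fx₁≡0 fx₂≡0 x₁≢x₀ x₂≢x₀ x₁≢x₂ =
    (λ q≡3 → let m≡false = card%4≡3⇒¬isSquare?-1 q≡3 in
      (λ χ≡1 → Equivalence.from (order4⇔ (q≡p χ≡1) m≡false (someRootHalves[p,p,r,false] p r)) _) ,
      (λ χ≢1 →
        let order4⇔T = order4⇔ (q≡¬p (¬χ≡1⇒isSquare?≡false f′x₀≢0 χ≢1)) m≡false (someRootHalves[p,¬p,r,false] p r)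
            χ≡1⇔T′ = χ≡1⇔T f′x₁≢0 (trans isSquare?-f′x₁ (cong (λ m → (m ≡ᵇ p) ≡ᵇ r) m≡false))
        in mk⇔ (λ order4 → n≡3 , Equivalence.from χ≡1⇔T′ (Equivalence.to order4⇔T order4))
               (λ (_ , χ≡1) → Equivalence.from order4⇔T (Equivalence.to χ≡1⇔T′ χ≡1)))) ,
    (λ q≡1 → let m≡true = card%4≡1⇒isSquare?-1 q≡1 in
      (λ n≡1 → ⊥-elim (3≢1 (trans (sym n≡3) n≡1))) ,
      λ _ → (λ χ≡1 → ⇔-trans (order4⇔ (q≡p χ≡1) m≡true (someRootHalves[p,p,r,true] p r))
                              (⇔-sym (χ≡1⇔T (x-y≢0 (x₁≢x₀ ∘ sym)) refl))) ,
            (λ χ≡-1 → ⇔-trans (order4⇔ (q≡¬p (χ≡-1⇒isSquare?≡false f′x₀≢0 χ≡-1)) m≡true (someRootHalves[p,¬p,r,true] p r))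
                               (⇔-sym (χ≡1⇔T (x-y≢0 x₁≢x₂) refl))))
    where
      n≡3 = numRoots≡3 nonsingular fx₀≡0 (cofactor-root fx₀≡0 fx₁≡0 x₁≢x₀)
      3≢1 : ¬ 3 ≡ 1
      3≢1 ()
      f′x₀≢0 : ¬ f′ x₀ ≡ 0#
      f′x₀≢0 f′x₀≡0 = f≡0∧f′≡0⇒singular fx₀≡0 f′x₀≡0 nonsingular
      f′x₁≢0 : ¬ f′ x₁ ≡ 0#
      f′x₁≢0 f′x₁≡0 = f≡0∧f′≡0⇒singular fx₁≡0 f′x₁≡0 nonsingular
      sp₀ = three-roots⇒splits fx₀≡0 fx₁≡0 fx₂≡0 x₁≢x₀ x₂≢x₀ x₁≢x₂
      p = isSquare? (x₀ - x₁)
      q = isSquare? (x₀ - x₂)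
      r = isSquare? (x₁ - x₂)
      m = isSquare? (- 1#)

      isSquare?-f′x₀ : isSquare? (f′ x₀) ≡ (p ≡ᵇ q)
      isSquare?-f′x₀ = trans (cong isSquare? (f′≡product sp₀)) (isSquare?-* (x-y≢0 (x₁≢x₀ ∘ sym)) (x-y≢0 (x₂≢x₀ ∘ sym)))

      isSquare?-f′x₁ : isSquare? (f′ x₁) ≡ ((m ≡ᵇ p) ≡ᵇ r)
      isSquare?-f′x₁ = trans (cong isSquare? (f′≡product (splits-swap sp₀)))
        (trans (isSquare?-* (x-y≢0 x₁≢x₀) (x-y≢0 x₁≢x₂)) (cong (_≡ᵇ r) (isSquare?-swap (x₁≢x₀ ∘ sym))))

      q≡p : χ (f′ x₀) ≡ 1ℤ → q ≡ p
      q≡p χ≡1 = ≡ᵇ≡true⇒≡ p q (trans (sym isSquare?-f′x₀) (Equivalence.to (χ≡1⇔isSquare? f′x₀≢0) χ≡1))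

      q≡¬p : isSquare? (f′ x₀) ≡ false → q ≡ not p
      q≡¬p □f′x₀≡false = ≡ᵇ≡false⇒≡not p q (trans (sym isSquare?-f′x₀) □f′x₀≡false)

      order4⇔ : ∀ {q′ m′ b} → q ≡ q′ → m ≡ m′ → someRootHalves p q′ r m′ ≡ b → HasPointOfOrder4 ⇔ T b
      order4⇔ refl refl eq = subst (λ b → HasPointOfOrder4 ⇔ T b) eq
        (order4⇔someRootHalves nonsingular fx₀≡0 fx₁≡0 fx₂≡0 x₁≢x₀ x₂≢x₀ x₁≢x₂)

proposition5p2 : (F : FiniteField) → (A B x₀ x₁ x₂ : FiniteField.Carrier F) →
    let open FiniteField F in
    let open Curve F A B in
    -- q odd (characteristic ≠ 2)
    card % 2 ≡ 1 →
    ¬ (1# + 1# ≡ 0#) →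
    Nonsingular →
    f x₀ ≡ 0# →
    -- when n = 3, x₁ and x₂ are the two roots of f other than x₀
    (numRoots ≡ 3 →
      (¬ x₁ ≡ x₀) × (¬ x₂ ≡ x₀) × (¬ x₁ ≡ x₂) × (f x₁ ≡ 0#) × (f x₂ ≡ 0#)) →
    -- case q ≡ 3 mod 4
    (card % 4 ≡ 3 →
      (χ (f′ x₀) ≡ 1ℤ → HasPointOfOrder4)
      × (¬ χ (f′ x₀) ≡ 1ℤ →
          (HasPointOfOrder4 ⇔ ((numRoots ≡ 3) × (χ (f′ x₁) ≡ 1ℤ)))))
    ×
    -- case q ≡ 1 mod 4
    (card % 4 ≡ 1 →
      (numRoots ≡ 1 → (HasPointOfOrder4 ⇔ (χ (f′ x₀) ≡ 1ℤ)))
      × (¬ numRoots ≡ 1 →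
          (χ (f′ x₀) ≡ 1ℤ → (HasPointOfOrder4 ⇔ (χ (x₀ - x₁) ≡ 1ℤ)))
          × (χ (f′ x₀) ≡ -1ℤ → (HasPointOfOrder4 ⇔ (χ (x₁ - x₂) ≡ 1ℤ)))))
-- q odd is used only through 1 + 1 ≢ 0.
proposition5p2 F A B x₀ x₁ x₂ _ 1+1≢0 nonsingular fx₀≡0 other-roots =
  by-cases (∃? (λ r → cofactor x₀ r ≡ 0#) (λ r → cofactor x₀ r ≟ 0#))
  where
    open FieldFacts F
    open CubicRoots F 1+1≢0 A B
    open Cases F 1+1≢0 A B

    by-cases : Dec (∃ λ r → cofactor x₀ r ≡ 0#) → Conclusion F A B x₀ x₁ x₂
    by-cases (no ¬∃r) = one-root nonsingular x₁ x₂ fx₀≡0 (λ r cofactor≡0 → ¬∃r (r , cofactor≡0))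
    by-cases (yes (r , cofactor≡0)) =
      let x₁≢x₀ , x₂≢x₀ , x₁≢x₂ , fx₁≡0 , fx₂≡0 = other-roots (numRoots≡3 nonsingular fx₀≡0 cofactor≡0)
      in three-roots nonsingular fx₀≡0 fx₁≡0 fx₂≡0 x₁≢x₀ x₂≢x₀ x₁≢x₂
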